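{- Let $q>2$ be a power of $2$, let $\delta\in\mathbb{F}_q$ have absolute trace $1$, and let $\epsilon\in\mathbb{F}_{q^2}\setminus\mathbb{F}_q$ satisfy $\epsilon^2+\epsilon+\delta=0$. Let $a=a_0+\epsilon a_1\in\mathbb{F}_{q^2}^*$, $b=b_0+\epsilon b_1\in\mathbb{F}_{q^2}\setminus\mathbb{F}_q$ ($a_i,b_i\in\mathbb{F}_q$), and let $\mathcal{M}_{a,b}$ be the BM quasi-Hermitian variety of $\mathrm{PG}(3,q^2)$: \[ \mathcal{M}_{a,b}=\{(1,x,y,z): z+a(x^2+y^2)-b(x^{q+1}+y^{q+1})\in\mathbb{F}_q\}\ \cup\ \{(0,X,Y,Z): X^{q+1}+Y^{q+1}=0\}. \] Then in the Barlotti--Cofman representation in $\mathrm{PG}(6,q)$ the affine points of $\mathcal{M}_{a,b}$ correspond to the affine points of the quadratic cone $\mathcal{B}'$ with equation \[ x_0x_6+a_0(x_2^2+x_4^2)+a_1(x_1^2+x_2^2+\delta x_2^2+x_3^2+x_4^2+\delta x_4^2)+b_1(x_1^2+\delta x_2^2+x_1x_2+x_3^2+\delta x_4^2+x_3x_4)=0, \] which has vertex $V=(0,0,0,0,0,1,0)$ and whose base is a hyperbolic quadric. The points at infinity of $\mathcal{M}_{a,b}$ are represented by $q^3+q^2+1$ lines of the spread $\mathcal{S}$, namely the lines $r_P$ for $P\in\{(0,X,Y,Z):X^{q+1}+Y^{q+1}=0\}$, and among these lines $q^2+1$ are contained in $\mathcal{B}'$.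
   Context: Points of $\mathrm{PG}(3,q^2)$ have homogeneous coordinates $(J,X,Y,Z)$, with plane at infinity $J=0$ and affine points $(1,x,y,z)$; points of $\mathrm{PG}(6,q)$ have homogeneous coordinates $(x_0,\dots,x_6)$, with hyperplane at infinity $x_0=0$. Every $c\in\mathbb{F}_{q^2}$ is written uniquely as $c=c_0+\epsilon c_1$, $c_0,c_1\in\mathbb{F}_q$. Barlotti--Cofman representation: the affine point $(1,x,y,z)$ with $x=x_1+\epsilon x_2$, $y=x_3+\epsilon x_4$, $z=x_5+\epsilon x_6$ corresponds to $(1,x_1,\dots,x_6)$; a point $P=(0,u,v,w)$ at infinity corresponds to the spread line $r_P$ of $\{x_0=0\}$ consisting of the points $(0,u'_0,u'_1,v'_0,v'_1,w'_0,w'_1)$ with $(u',v',w')=(\lambda u,\lambda v,\lambda w)$, $\lambda\in\mathbb{F}_{q^2}^*$. The lines $r_P$ form a Desarguesian line spread $\mathcal{S}$ of $\{x_0=0\}$. The base of $\mathcal{B}'$ is the quadric of $\mathrm{PG}(5,q)$ in coordinates $x_0,x_1,x_2,x_3,x_4,x_6$ given by the same equation. -}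

module Defs where

open import Level using (Level)
open import Algebra.Bundles using (CommutativeRing)
open import Data.Nat as ℕ using (ℕ; zero; suc)
open import Data.Bool using (Bool; true; false; _∧_; if_then_else_; not)
open import Data.Product using (_×_; _,_; proj₁; proj₂; ∃; Σ)
open import Data.List as List using (List; length; filterᵇ; cartesianProduct)
open import Data.List.Relation.Unary.Any using (Any)
open import Data.List.Relation.Unary.AllPairs using (AllPairs)
open import Data.Vec as Vec using (Vec; []; _∷_)
open import Data.Vec.Relation.Binary.Pointwise.Inductive using (Pointwise)
open import Relation.Nullary using (¬_; does)
open import Relation.Binary using (Decidable)

-- Everything is relative to a commutative ring R (to be a finite field F_q),
-- a decidable equality on it, and an explicit listing  els  of its elements.
module BM {c ℓ : Level} (R : CommutativeRing c ℓ)
          (_≟_ : Decidable (CommutativeRing._≈_ R))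
          (els : List (CommutativeRing.Carrier R)) where

  open CommutativeRing R

  F : Set c
  F = Carrier

  _==_ : F → F → Bool
  x == y = does (x ≟ y)

  allᵇ : ∀ {a} {A : Set a} → (A → Bool) → List A → Bool
  allᵇ p List.[]       = true
  allᵇ p (x List.∷ xs) = p x ∧ allᵇ p xs

  pow : F → ℕ → F
  pow x zero    = 1#
  pow x (suc n) = x * pow x n

  IsFiniteFieldOfOrder : ℕ → Set (c Level.⊔ ℓ)
  IsFiniteFieldOfOrder q =
      ¬ (0# ≈ 1#)
    × (∀ x → ¬ (x ≈ 0#) → ∃ λ y → x * y ≈ 1#)
    × (∀ x → Any (x ≈_) els)
    × AllPairs (λ x y → ¬ (x ≈ y)) els
    × length els ≡ℕ q
    where open import Relation.Binary.PropositionalEquality renaming (_≡_ to _≡ℕ_)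

  absTrace : ℕ → F → F
  absTrace zero    δ = 0#
  absTrace (suc i) δ = absTrace i δ + pow δ (2 ℕ.^ i)

  -- F_{q^2} = F_q(ε),  ε^2 + ε + δ = 0 ; the element c0 + ε c1 is the pair (c0 , c1)
  module Ext (δ : F) where

    F2 : Set c
    F2 = F × F

    0₂ 1₂ : F2
    0₂ = 0# , 0#
    1₂ = 1# , 0#

    _⊕_ _⊖_ _⊗_ : F2 → F2 → F2
    (a0 , a1) ⊕ (b0 , b1) = a0 + b0 , a1 + b1
    (a0 , a1) ⊖ (b0 , b1) = a0 - b0 , a1 - b1
    -- ε^2 = - ε - δ
    (a0 , a1) ⊗ (b0 , b1) = a0 * b0 - δ * (a1 * b1) , (a0 * b1 + a1 * b0) - a1 * b1

    pow₂ : F2 → ℕ → F2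
    pow₂ x zero    = 1₂
    pow₂ x (suc n) = x ⊗ pow₂ x n

    _≈₂_ : F2 → F2 → Set ℓ
    (a0 , a1) ≈₂ (b0 , b1) = (a0 ≈ b0) × (a1 ≈ b1)

    _==₂_ : F2 → F2 → Bool
    (a0 , a1) ==₂ (b0 , b1) = (a0 == b0) ∧ (a1 == b1)

    els₂ : List F2
    els₂ = cartesianProduct els els

    InMaff : ℕ → F2 → F2 → F2 → F2 → F2 → Set ℓ
    InMaff q a b x y z =
      proj₂ ((z ⊕ (a ⊗ (pow₂ x 2 ⊕ pow₂ y 2))) ⊖ (b ⊗ (pow₂ x (suc q) ⊕ pow₂ y (suc q)))) ≈ 0#

    inMinfᵇ : ℕ → F2 × F2 × F2 → Bool
    inMinfᵇ q (X , Y , Z) = (pow₂ X (suc q) ⊕ pow₂ Y (suc q)) ==₂ 0₂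

    -- points of the plane at infinity of PG(3,q^2): each projective point (0,X,Y,Z)
    -- is represented by the unique (X,Y,Z) ≠ 0 whose first nonzero coordinate is 1
    normalisedᵇ : F2 × F2 × F2 → Bool
    normalisedᵇ (X , Y , Z) =
      if not (X ==₂ 0₂) then X ==₂ 1₂
      else if not (Y ==₂ 0₂) then Y ==₂ 1₂
      else Z ==₂ 1₂

    triples : List (F2 × F2 × F2)
    triples = cartesianProduct els₂ (cartesianProduct els₂ els₂)

    Q7 : (a0 a1 b1 : F) → Vec F 7 → F
    Q7 a0 a1 b1 (x0 ∷ x1 ∷ x2 ∷ x3 ∷ x4 ∷ x5 ∷ x6 ∷ []) =
        x0 * x6
      + a0 * (x2 * x2 + x4 * x4)
      + a1 * (x1 * x1 + x2 * x2 + δ * (x2 * x2) + x3 * x3 + x4 * x4 + δ * (x4 * x4))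
      + b1 * (x1 * x1 + δ * (x2 * x2) + x1 * x2 + x3 * x3 + δ * (x4 * x4) + x3 * x4)

    -- Barlotti–Cofman: points of the spread line r_P, P = (0,u,v,w), are
    -- (0, (λu)_0, (λu)_1, (λv)_0, (λv)_1, (λw)_0, (λw)_1), λ ∈ F_{q^2}^*
    rPoint : F2 × F2 × F2 → F2 → Vec F 7
    rPoint (u , v , w) λ′ with λ′ ⊗ u | λ′ ⊗ v | λ′ ⊗ w
    ... | (u0 , u1) | (v0 , v1) | (w0 , w1) = 0# ∷ u0 ∷ u1 ∷ v0 ∷ v1 ∷ w0 ∷ w1 ∷ []

    -- r_P ⊆ B'  (λ = 0 gives the zero vector, on which Q7 vanishes, so it may be included)
    lineInB'ᵇ : (a0 a1 b1 : F) → F2 × F2 × F2 → Bool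
    lineInB'ᵇ a0 a1 b1 P = allᵇ (λ λ′ → Q7 a0 a1 b1 (rPoint P λ′) == 0#) els₂

  _≈v_ : ∀ {n} → Vec F n → Vec F n → Set (c Level.⊔ ℓ)
  _≈v_ = Pointwise _≈_

  scale : ∀ {n} → F → Vec F n → Vec F n
  scale t = Vec.map (t *_)

  _+v_ : ∀ {n} → Vec F n → Vec F n → Vec F n
  _+v_ = Vec.zipWith _+_

  polar : ∀ {n} → (Vec F n → F) → Vec F n → Vec F n → F
  polar Q u v = Q (u +v v) - Q u - Q v

  -- the quadric {Q = 0} is a cone with vertex exactly the point ⟨V⟩:
  -- V is a singular point, and every singular vector is a multiple of V
  HasVertex : ∀ {n} → (Vec F n → F) → Vec F n → Set (c Level.⊔ ℓ)
  HasVertex Q V =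
      (Q V ≈ 0# × (∀ w → polar Q V w ≈ 0#))
    × (∀ w → Q w ≈ 0# → (∀ u → polar Q w u ≈ 0#) → ∃ λ t → w ≈v scale t V)

  dot : ∀ {n} → Vec F n → Vec F n → F
  dot u v = Vec.foldr _ _+_ 0# (Vec.zipWith _*_ u v)

  matVec : ∀ {m n} → Vec (Vec F n) m → Vec F n → Vec F m
  matVec M v = Vec.map (λ row → dot row v) M

  hypForm : Vec F 6 → F
  hypForm (v0 ∷ v1 ∷ v2 ∷ v3 ∷ v4 ∷ v5 ∷ []) = v0 * v1 + v2 * v3 + v4 * v5

  -- a quadric {Q = 0} of PG(5,q) is hyperbolic: projectively equivalent to
  -- x0x1 + x2x3 + x4x5 = 0 (invertible linear change of coordinates, nonzero scalar)
  IsHyperbolic : (Vec F 6 → F) → Set (c Level.⊔ ℓ)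
  IsHyperbolic Q =
    Σ (Vec (Vec F 6) 6) λ M → Σ (Vec (Vec F 6) 6) λ N →
        (∀ v → matVec M (matVec N v) ≈v v)
      × (∀ v → matVec N (matVec M v) ≈v v)
      × Σ F (λ k → ¬ (k ≈ 0#) × (∀ v → Q (matVec M v) ≈ k * hypForm v))

  -- base of B': same equation in coordinates x0,x1,x2,x3,x4,x6 (x5 omitted)
  baseOf : (Vec F 7 → F) → Vec F 6 → F
  baseOf Q (x0 ∷ x1 ∷ x2 ∷ x3 ∷ x4 ∷ x6 ∷ []) = Q (x0 ∷ x1 ∷ x2 ∷ x3 ∷ x4 ∷ 0# ∷ x6 ∷ [])

  vertexV : Vec F 7
  vertexV = 0# ∷ 0# ∷ 0# ∷ 0# ∷ 0# ∷ 1# ∷ 0# ∷ []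

  count : ∀ {a} {A : Set a} → (A → Bool) → List A → ℕ
  count p xs = length (filterᵇ p xs)

{-# OPTIONS --safe #-}
module Submission where

-- Since Tr(δ) = 1, X² + X + δ has no root in F_q, and pairs (x0 , x1) = x0 + ε x1 model F_{q²}.
-- Squaring h times gives ε^q = ε + Tr(δ) = ε + 1, and c^q = c on F_q (Fermat), so x^q is the
-- conjugate (x0 + x1) + ε x1 and x^{q+1} is the norm N(x) = x0² + x0 x1 + δ x1², an anisotropic
-- form on F_q². Substituting x^{q+1} = N(x) turns the condition defining the affine part of
-- M_{a,b} into a polynomial identity. The polar form of B' is
-- x0 y6 + x6 y0 + b1 (x1 y2 + x2 y1 + x3 y4 + x4 y3), whose radical is ⟨V⟩, and the base of B' is a
-- hyperbolic plane plus two copies of one binary form, hence hyperbolic.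
-- A point at infinity lies on M_{a,b} iff N(X) = N(Y); the normalised ones are (1 , Y , Z) with
-- N(Y) = 1 and (0 , 0 , 1). Every c ∈ F_q is a square, so all nonzero norm fibres have equal size,
-- and the fibre over 1 has (q² - 1) / (q - 1) = q + 1 elements: (q + 1) q² + 1 points in all.
-- On r_P, when N(X) = N(Y), Q is λ ↦ (a (λ (X + Y))²)₁, which vanishes identically iff X = Y since
-- a ≠ 0 and N is anisotropic; this leaves the q² + 1 points (1 , 1 , Z) and (0 , 0 , 1).

open import Defs
open import Level using (0ℓ)
open import Algebra.Bundles using (CommutativeRing; CommutativeMonoid; Semiring)
open import Algebra.Bundles.Raw using (RawRing)
open import Data.Bool using (Bool; true; false; _xor_; _∧_; _∨_; not; if_then_else_)
open import Data.Bool.Properties using (∧-identityʳ; ∧-zeroʳ; ∨-identityʳ)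
open import Data.Empty using (⊥-elim)
open import Data.Fin using (Fin; zero; suc; #_)
open import Data.Maybe using (Maybe; just; nothing)
open import Data.Nat using (ℕ; zero; suc; _^_; _≤_; NonZero; >-nonZero; s≤s⁻¹) renaming (_+_ to _+ℕ_; _*_ to _*ℕ_)
open import Data.Nat.Properties using (*-suc; *-cancelʳ-≡; suc-injective; *-monoʳ-≤; m^n>0)
  renaming (+-identityʳ to +ℕ-identityʳ; *-identityˡ to *ℕ-identityˡ; *-identityʳ to *ℕ-identityʳ; +-comm to +ℕ-comm)
open import Data.Product using (_×_; _,_; proj₁; proj₂; ∃)
open import Data.List using (List; []; _∷_; _++_; map; length; filterᵇ; cartesianProduct)
open import Data.List.Relation.Unary.All as All using (All; []; _∷_)
open import Data.List.Relation.Unary.Any as Any using (Any; here; there)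
open import Data.List.Relation.Unary.Any.Properties using (cartesianProduct⁺)
open import Data.List.Relation.Unary.AllPairs using (AllPairs; []; _∷_)
open import Data.Vec as Vec using (Vec; []; _∷_; lookup)
open import Data.Vec.Relation.Binary.Pointwise.Inductive using ([]; _∷_)
open import Function.Bundles using (_⇔_; mk⇔; Equivalence)
open import Relation.Binary using (Decidable; IsEquivalence)
open import Relation.Binary.Bundles using (Setoid)
open import Data.Product.Relation.Binary.Pointwise.NonDependent using (×-setoid)
open import Relation.Binary.PropositionalEquality as ≡ using (_≡_)
open import Relation.Nullary using (¬_; Dec; yes; no; does; proof; _×-dec_)
open import Relation.Nullary.Decidable using (dec-true; dec-false; does-⇔)
open import Relation.Nullary.Reflects using (Reflects; invert)
import Relation.Binary.Reasoning.Setoid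

module ListCount where

  open import Data.Nat using (_+_; _*_)
  open import Data.Nat.Properties using (+-suc)
  open ≡ using (refl; sym; trans; cong; cong₂)

  -- The same function as BM.count, which is only in scope under the ring parameters of BM.
  count : ∀ {a} {A : Set a} → (A → Bool) → List A → ℕ
  count p xs = length (filterᵇ p xs)

  module _ {a} {A : Set a} where

    count-cong : ∀ {p r : A → Bool} → (∀ x → p x ≡ r x) → ∀ xs → count p xs ≡ count r xs
    count-cong p≗r []       = refl
    count-cong {p} {r} p≗r (x ∷ xs) with p x | r x | p≗r x
    ... | true  | true  | _ = cong suc (count-cong p≗r xs)
    ... | false | false | _ = count-cong p≗r xs

    count-true : ∀ (xs : List A) → count (λ _ → true) xs ≡ length xs
    count-true []       = refl
    count-true (x ∷ xs) = cong suc (count-true xs)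

    count-false : ∀ (xs : List A) → count (λ _ → false) xs ≡ 0
    count-false []       = refl
    count-false (x ∷ xs) = count-false xs

    count-++ : ∀ (p : A → Bool) xs ys → count p (xs ++ ys) ≡ count p xs + count p ys
    count-++ p []       ys = refl
    count-++ p (x ∷ xs) ys with p x
    ... | true  = cong suc (count-++ p xs ys)
    ... | false = count-++ p xs ys

    count-∨ : ∀ (p r : A → Bool) → (∀ x → p x ∧ r x ≡ false) → ∀ xs →
              count (λ x → p x ∨ r x) xs ≡ count p xs + count r xs
    count-∨ p r disjoint []       = refl
    count-∨ p r disjoint (x ∷ xs) with p x | r x | disjoint x
    ... | true  | false | _ = cong suc (count-∨ p r disjoint xs)
    ... | false | true  | _ = trans (cong suc (count-∨ p r disjoint xs)) (sym (+-suc _ _))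
    ... | false | false | _ = count-∨ p r disjoint xs

    count-complement : ∀ (p : A → Bool) xs → count p xs + count (λ x → not (p x)) xs ≡ length xs
    count-complement p []       = refl
    count-complement p (x ∷ xs) with p x
    ... | true  = cong suc (count-complement p xs)
    ... | false = trans (+-suc _ _) (cong suc (count-complement p xs))

  count-map : ∀ {a b} {A : Set a} {B : Set b} (p : B → Bool) (f : A → B) xs →
              count p (map f xs) ≡ count (λ x → p (f x)) xs
  count-map p f []       = refl
  count-map p f (x ∷ xs) with p (f x)
  ... | true  = cong suc (count-map p f xs)
  ... | false = count-map p f xs

  count-× : ∀ {a b} {A : Set a} {B : Set b} (p : A → Bool) (r : B → Bool) xs ys →
            count (λ xy → p (proj₁ xy) ∧ r (proj₂ xy)) (cartesianProduct xs ys) ≡ count p xs * count r ys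
  count-× p r []       ys = refl
  count-× p r (x ∷ xs) ys = begin
    count pr (map (x ,_) ys ++ cartesianProduct xs ys)           ≡⟨ count-++ pr (map (x ,_) ys) _ ⟩
    count pr (map (x ,_) ys) + count pr (cartesianProduct xs ys) ≡⟨ cong₂ _+_ (count-map pr (x ,_) ys) (count-× p r xs ys) ⟩
    count (λ y → p x ∧ r y) ys + count p xs * count r ys         ≡⟨ cong (_+ count p xs * count r ys) (row (p x)) ⟩
    (if p x then count r ys else 0) + count p xs * count r ys    ≡⟨ first-row ⟨
    count p (x ∷ xs) * count r ys                                ∎
    where
    open ≡.≡-Reasoning
    pr = λ xy → p (proj₁ xy) ∧ r (proj₂ xy)
    row : ∀ b → count (λ y → b ∧ r y) ys ≡ (if b then count r ys else 0)
    row true  = refl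
    row false = count-false ys
    first-row : count p (x ∷ xs) * count r ys ≡ (if p x then count r ys else 0) + count p xs * count r ys
    first-row with p x
    ... | true  = refl
    ... | false = refl

  EnumeratesOnce : ∀ {a} {A : Set a} → (A → A → Bool) → List A → Set a
  EnumeratesOnce _≐_ xs = ∀ z → count (_≐ z) xs ≡ 1

  module _ {a} {A : Set a} {_≐_ : A → A → Bool} where

    map-enumeratesOnce : ∀ (f g : A → A) → (∀ x z → f x ≐ z ≡ x ≐ g z) →
                         ∀ xs → EnumeratesOnce _≐_ xs → EnumeratesOnce _≐_ (map f xs)
    map-enumeratesOnce f g adjoint xs once z =
      trans (count-map (_≐ z) f xs) (trans (count-cong (λ x → adjoint x z) xs) (once (g z)))

  module _ {a b} {A : Set a} {B : Set b} {_≐_ : A → A → Bool} {_≑_ : B → B → Bool} where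

    cartesianProduct-enumeratesOnce :
      ∀ xs ys → EnumeratesOnce _≐_ xs → EnumeratesOnce _≑_ ys →
      EnumeratesOnce (λ u v → proj₁ u ≐ proj₁ v ∧ proj₂ u ≑ proj₂ v) (cartesianProduct xs ys)
    cartesianProduct-enumeratesOnce xs ys onceˡ onceʳ (z , w) =
      trans (count-× (_≐ z) (_≑ w) xs ys) (cong₂ _*_ (onceˡ z) (onceʳ w))

module BigOp {c ℓ} (M : CommutativeMonoid c ℓ) where

  open CommutativeMonoid M
  open import Algebra.Definitions.RawMonoid rawMonoid public using () renaming (_×_ to _times_)
  open import Algebra.Properties.CommutativeSemigroup commutativeSemigroup using (interchange)
  open import Relation.Binary.Reasoning.Setoid setoid
  open ListCount using (count; EnumeratesOnce)

  ∏ : ∀ {a} {A : Set a} → (A → Carrier) → List A → Carrier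
  ∏ f []       = ε
  ∏ f (x ∷ xs) = f x ∙ ∏ f xs

  module _ {a} {A : Set a} where

    ∏-cong : ∀ {f g : A → Carrier} → (∀ x → f x ≈ g x) → ∀ xs → ∏ f xs ≈ ∏ g xs
    ∏-cong f≈g []       = refl
    ∏-cong f≈g (x ∷ xs) = ∙-cong (f≈g x) (∏-cong f≈g xs)

    ∏-ε : ∀ (xs : List A) → ∏ (λ _ → ε) xs ≈ ε
    ∏-ε []       = refl
    ∏-ε (x ∷ xs) = trans (identityˡ _) (∏-ε xs)

    ∏-∙ : ∀ (f g : A → Carrier) xs → ∏ (λ x → f x ∙ g x) xs ≈ ∏ f xs ∙ ∏ g xs
    ∏-∙ f g []       = sym (identityˡ ε)
    ∏-∙ f g (x ∷ xs) = trans (∙-congˡ (∏-∙ f g xs)) (interchange _ _ _ _)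

    ∏-if : ∀ (p : A → Bool) z xs → ∏ (λ x → if p x then z else ε) xs ≈ count p xs times z
    ∏-if p z []       = refl
    ∏-if p z (x ∷ xs) with p x
    ... | true  = ∙-congˡ (∏-if p z xs)
    ... | false = trans (identityˡ _) (∏-if p z xs)

  ∏-map : ∀ {a b} {A : Set a} {B : Set b} (f : B → Carrier) (g : A → B) xs →
          ∏ f (map g xs) ≈ ∏ (λ x → f (g x)) xs
  ∏-map f g []       = refl
  ∏-map f g (x ∷ xs) = ∙-congˡ (∏-map f g xs)

  ∏-swap : ∀ {a b} {A : Set a} {B : Set b} (f : A → B → Carrier) xs ys →
           ∏ (λ x → ∏ (f x) ys) xs ≈ ∏ (λ y → ∏ (λ x → f x y) xs) ys
  ∏-swap f []       ys = sym (∏-ε ys)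
  ∏-swap f (x ∷ xs) ys = trans (∙-congˡ (∏-swap f xs ys)) (sym (∏-∙ (f x) (λ y → ∏ (λ x → f x y) xs) ys))

  module _ {a} {A : Set a} (_≐_ : A → A → Bool) (≐-sym : ∀ x y → x ≐ y ≡ y ≐ x) where

    ∏-once : ∀ xs → EnumeratesOnce _≐_ xs → ∀ y z → ∏ (λ x → if x ≐ y then z else ε) xs ≈ z
    ∏-once xs once y z = trans (∏-if (_≐ y) z xs) (≡.subst (λ n → n times z ≈ z) (≡.sym (once y)) (identityʳ z))

    -- Both sides equal the product of [x ≐ y] f x over all pairs (x , y).
    ∏-reindex : ∀ (f : A → Carrier) → (∀ x y → x ≐ y ≡ true → f x ≈ f y) →
                ∀ xs ys → EnumeratesOnce _≐_ xs → EnumeratesOnce _≐_ ys → ∏ f xs ≈ ∏ f ys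
    ∏-reindex f f-resp xs ys onceˣ onceʸ = begin
      ∏ f xs                                                      ≈⟨ ∏-cong spread xs ⟨
      ∏ (λ x → ∏ (λ y → if x ≐ y then f x else ε) ys) xs          ≈⟨ ∏-swap (λ x y → if x ≐ y then f x else ε) xs ys ⟩
      ∏ (λ y → ∏ (λ x → if x ≐ y then f x else ε) xs) ys          ≈⟨ ∏-cong collect ys ⟩
      ∏ f ys                                                      ∎
      where
      spread : ∀ x → ∏ (λ y → if x ≐ y then f x else ε) ys ≈ f x
      spread x = trans (∏-cong (λ y → ≡.subst (λ b → (if x ≐ y then f x else ε) ≈ (if b then f x else ε)) (≐-sym x y) refl) ys)
                       (∏-once ys onceʸ x (f x))
      collect : ∀ y → ∏ (λ x → if x ≐ y then f x else ε) xs ≈ f y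
      collect y = trans (∏-cong pick xs) (∏-once xs onceˣ y (f y))
        where
        pick : ∀ x → (if x ≐ y then f x else ε) ≈ (if x ≐ y then f y else ε)
        pick x with x ≐ y in x≐y
        ... | true  = f-resp x y x≐y
        ... | false = refl

module CountingSums where

  open import Data.Nat using (_+_; _*_)
  open import Data.Nat.Properties using (+-0-commutativeMonoid; +-commutativeSemigroup; *-suc; *-zeroʳ; +-assoc)
  open import Algebra.Properties.CommutativeSemigroup +-commutativeSemigroup using (x∙yz≈y∙xz)
  open ≡ using (refl; sym; trans; cong; cong₂)
  open ListCount
  open BigOp +-0-commutativeMonoid public using () renaming (∏ to ∑; ∏-cong to ∑-cong; ∏-swap to ∑-swap)
  open BigOp +-0-commutativeMonoid using (∏-reindex)

  module _ {a} {A : Set a} where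

    count≡∑ : ∀ (p : A → Bool) xs → count p xs ≡ ∑ (λ x → if p x then 1 else 0) xs
    count≡∑ p []       = refl
    count≡∑ p (x ∷ xs) with p x
    ... | true  = cong suc (count≡∑ p xs)
    ... | false = count≡∑ p xs

    count-reindex : ∀ (_≐_ : A → A → Bool) → (∀ x y → x ≐ y ≡ y ≐ x) →
                    ∀ (p : A → Bool) → (∀ x y → x ≐ y ≡ true → p x ≡ p y) →
                    ∀ xs ys → EnumeratesOnce _≐_ xs → EnumeratesOnce _≐_ ys → count p xs ≡ count p ys
    count-reindex _≐_ ≐-sym p p-resp xs ys onceˣ onceʸ =
      trans (count≡∑ p xs)
        (trans (∏-reindex _≐_ ≐-sym _ (λ x y x≐y → cong (λ b → if b then 1 else 0) (p-resp x y x≐y)) xs ys onceˣ onceʸ)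
          (sym (count≡∑ p ys)))

    ∑-if : ∀ (p : A → Bool) u v xs →
           ∑ (λ x → if p x then u else v) xs ≡ u * count p xs + v * count (λ x → not (p x)) xs
    ∑-if p u v []       = sym (cong₂ _+_ (*-zeroʳ u) (*-zeroʳ v))
    ∑-if p u v (x ∷ xs) with p x
    ... | true  = trans (cong (u +_) (∑-if p u v xs))
                        (trans (sym (+-assoc u (u * m) (v * n))) (cong (_+ v * n) (sym (*-suc u m))))
      where m = count p xs; n = count (λ x → not (p x)) xs
    ... | false = trans (cong (v +_) (∑-if p u v xs))
                        (trans (x∙yz≈y∙xz v (u * m) (v * n)) (cong (u * m +_) (sym (*-suc v n))))
      where m = count p xs; n = count (λ x → not (p x)) xs

module DecidedEquivalence {a ℓ} {A : Set a} {_∼_ : A → A → Set ℓ}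
  (isEquivalence : IsEquivalence _∼_) (_≟_ : Decidable _∼_) where

  open IsEquivalence isEquivalence

  _≐_ : A → A → Bool
  x ≐ y = does (x ≟ y)

  ≐-true : ∀ {x y} → x ∼ y → x ≐ y ≡ true
  ≐-true {x} {y} = dec-true (x ≟ y)

  ≐-false : ∀ {x y} → ¬ (x ∼ y) → x ≐ y ≡ false
  ≐-false {x} {y} = dec-false (x ≟ y)

  ≐-sound : ∀ {x y} → x ≐ y ≡ true → x ∼ y
  ≐-sound {x} {y} x≐y = invert (≡.subst (Reflects (x ∼ y)) x≐y (proof (x ≟ y)))

  ≐-cong : ∀ {x y u v} → (x ∼ y ⇔ u ∼ v) → x ≐ y ≡ u ≐ v
  ≐-cong {x} {y} {u} {v} x∼y⇔u∼v = does-⇔ x∼y⇔u∼v (x ≟ y) (u ≟ v)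

  ≐-sym : ∀ x y → x ≐ y ≡ y ≐ x
  ≐-sym x y = ≐-cong (mk⇔ sym sym)

  ≐-respˡ : ∀ {x y} z → x ∼ y → x ≐ z ≡ y ≐ z
  ≐-respˡ z x∼y = ≐-cong (mk⇔ (trans (sym x∼y)) (trans x∼y))

  ≐-respʳ : ∀ {x y} z → x ∼ y → z ≐ x ≡ z ≐ y
  ≐-respʳ z x∼y = ≐-cong (mk⇔ (λ z∼x → trans z∼x x∼y) (λ z∼y → trans z∼y (sym x∼y)))

Characteristic2 : ∀ {c ℓ} → CommutativeRing c ℓ → Set ℓ
Characteristic2 R = 1# + 1# ≈ 0#
  where open CommutativeRing R

-- The ring solver with coefficients in 𝔽₂, so that 1 + 1 normalises to 0.
module Char2Solver {c ℓ} (R : CommutativeRing c ℓ) (char2 : Characteristic2 R) where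

  open CommutativeRing R
  open import Algebra.Solver.Ring.AlmostCommutativeRing
    using (fromCommutativeRing; _-Raw-AlmostCommutative⟶_)
  open import Algebra.Properties.Ring ring using (-0#≈0#)
  open import Relation.Binary.Reasoning.Setoid setoid

  𝔽₂ : RawRing 0ℓ 0ℓ
  𝔽₂ = record
    { Carrier = Bool ; _≈_ = _≡_ ; _+_ = _xor_ ; _*_ = _∧_ ; -_ = λ x → x
    ; 0# = false ; 1# = true }

  ⟦_⟧𝔽₂ : Bool → Carrier
  ⟦ false ⟧𝔽₂ = 0#
  ⟦ true  ⟧𝔽₂ = 1#

  -1≈1 : - 1# ≈ 1#
  -1≈1 = begin
    - 1#               ≈⟨ +-identityˡ _ ⟨
    0# + - 1#          ≈⟨ +-congʳ char2 ⟨
    (1# + 1#) + - 1#   ≈⟨ +-assoc _ _ _ ⟩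
    1# + (1# + - 1#)   ≈⟨ +-congˡ (-‿inverseʳ _) ⟩
    1# + 0#            ≈⟨ +-identityʳ _ ⟩
    1#                 ∎

  ⟦⟧-homo : 𝔽₂ -Raw-AlmostCommutative⟶ fromCommutativeRing R
  ⟦⟧-homo = record
    { ⟦_⟧ = ⟦_⟧𝔽₂ ; +-homo = +-homo ; *-homo = *-homo ; -‿homo = -‿homo
    ; 0-homo = refl ; 1-homo = refl }
    where
    +-homo : ∀ a b → ⟦ a xor b ⟧𝔽₂ ≈ ⟦ a ⟧𝔽₂ + ⟦ b ⟧𝔽₂
    +-homo false b     = sym (+-identityˡ _)
    +-homo true  false = sym (+-identityʳ _)
    +-homo true  true  = sym char2
    *-homo : ∀ a b → ⟦ a ∧ b ⟧𝔽₂ ≈ ⟦ a ⟧𝔽₂ * ⟦ b ⟧𝔽₂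
    *-homo false b     = sym (zeroˡ _)
    *-homo true  false = sym (zeroʳ _)
    *-homo true  true  = sym (*-identityˡ _)
    -‿homo : ∀ a → ⟦ a ⟧𝔽₂ ≈ - ⟦ a ⟧𝔽₂
    -‿homo false = sym -0#≈0#
    -‿homo true  = sym -1≈1

  ≟𝔽₂ : (x y : Bool) → Maybe (⟦ x ⟧𝔽₂ ≈ ⟦ y ⟧𝔽₂)
  ≟𝔽₂ false false = just refl
  ≟𝔽₂ true  true  = just refl
  ≟𝔽₂ _     _     = nothing

  open import Algebra.Solver.Ring 𝔽₂ (fromCommutativeRing R) ⟦⟧-homo ≟𝔽₂ public

  syntaxRing : ℕ → RawRing 0ℓ 0ℓ
  syntaxRing n = record
    { Carrier = Polynomial n ; _≈_ = _≡_ ; _+_ = _:+_ ; _*_ = _:*_ ; -_ = :-_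
    ; 0# = con false ; 1# = con true }

-- At the ring R, mul, add, sub, q7, dot and matVec agree
-- definitionally with ⊗, ⊕, ⊖, Q7, dot and matVec of Defs; at syntaxRing n they are the terms
-- given to the solver.
module Formulas {c ℓ} (S : RawRing c ℓ) where

  open RawRing S

  infixl 6 _-_
  _-_ : Carrier → Carrier → Carrier
  x - y = x + - y

  mul : Carrier → Carrier × Carrier → Carrier × Carrier → Carrier × Carrier
  mul d (a0 , a1) (b0 , b1) = a0 * b0 - d * (a1 * b1) , (a0 * b1 + a1 * b0) - a1 * b1

  add : Carrier × Carrier → Carrier × Carrier → Carrier × Carrier
  add (a0 , a1) (b0 , b1) = a0 + b0 , a1 + b1

  sub : Carrier × Carrier → Carrier × Carrier → Carrier × Carrier
  sub (a0 , a1) (b0 , b1) = a0 - b0 , a1 - b1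

  norm : Carrier → Carrier × Carrier → Carrier
  norm d (x0 , x1) = x0 * x0 + x0 * x1 + d * (x1 * x1)

  q7 : (a0 a1 b1 d : Carrier) → Vec Carrier 7 → Carrier
  q7 a0 a1 b1 d (x0 ∷ x1 ∷ x2 ∷ x3 ∷ x4 ∷ x5 ∷ x6 ∷ []) =
      x0 * x6
    + a0 * (x2 * x2 + x4 * x4)
    + a1 * (x1 * x1 + x2 * x2 + d * (x2 * x2) + x3 * x3 + x4 * x4 + d * (x4 * x4))
    + b1 * (x1 * x1 + d * (x2 * x2) + x1 * x2 + x3 * x3 + d * (x4 * x4) + x3 * x4)

  polarCoefficients : Carrier → Vec Carrier 7 → Vec Carrier 7
  polarCoefficients b1 (w0 ∷ w1 ∷ w2 ∷ w3 ∷ w4 ∷ w5 ∷ w6 ∷ []) =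
    w6 ∷ b1 * w2 ∷ b1 * w1 ∷ b1 * w4 ∷ b1 * w3 ∷ 0# ∷ w0 ∷ []

  dot : ∀ {n} → Vec Carrier n → Vec Carrier n → Carrier
  dot u v = Vec.foldr _ _+_ 0# (Vec.zipWith _*_ u v)

  matVec : ∀ {m n} → Vec (Vec Carrier n) m → Vec Carrier n → Vec Carrier m
  matVec M v = Vec.map (λ row → dot row v) M

  -- The (x1 , x2)- and (x3 , x4)-parts of the base of B' are two copies of the binary form
  -- A X² + b1 X Y + B Y², and in characteristic 2 such a sum is hyperbolic; the columns of
  -- frame form a basis in which the base becomes b1² (v0 v1 + v2 v3 + v4 v5), and coframe is
  -- its inverse.
  frame : (b1 A B : Carrier) → Vec (Vec Carrier 6) 6
  frame b1 A B =
      (b1 * b1 ∷ 0# ∷ 0# ∷ 0# ∷ 0# ∷ 0# ∷ [])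
    ∷ (0#      ∷ 0# ∷ 1# ∷ B  ∷ 0# ∷ b1 ∷ [])
    ∷ (0#      ∷ 0# ∷ 0# ∷ 0# ∷ 1# ∷ A  ∷ [])
    ∷ (0#      ∷ 0# ∷ 1# ∷ B  ∷ 0# ∷ 0# ∷ [])
    ∷ (0#      ∷ 0# ∷ 0# ∷ b1 ∷ 1# ∷ A  ∷ [])
    ∷ (0#      ∷ 1# ∷ 0# ∷ 0# ∷ 0# ∷ 0# ∷ [])
    ∷ []

  coframe : (b1⁻¹ A B : Carrier) → Vec (Vec Carrier 6) 6
  coframe b1⁻¹ A B =
      (b1⁻¹ * b1⁻¹ ∷ 0#       ∷ 0#       ∷ 0#       ∷ 0#       ∷ 0# ∷ [])
    ∷ (0#          ∷ 0#       ∷ 0#       ∷ 0#       ∷ 0#       ∷ 1# ∷ [])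
    ∷ (0#          ∷ 0#       ∷ B * b1⁻¹ ∷ 1#       ∷ B * b1⁻¹ ∷ 0# ∷ [])
    ∷ (0#          ∷ 0#       ∷ b1⁻¹     ∷ 0#       ∷ b1⁻¹     ∷ 0# ∷ [])
    ∷ (0#          ∷ A * b1⁻¹ ∷ 1#       ∷ A * b1⁻¹ ∷ 0#       ∷ 0# ∷ [])
    ∷ (0#          ∷ b1⁻¹     ∷ 0#       ∷ b1⁻¹     ∷ 0#       ∷ 0# ∷ [])
    ∷ []

module Over {c ℓ} (R : CommutativeRing c ℓ) (_≟_ : Decidable (CommutativeRing._≈_ R))
  (els : List (CommutativeRing.Carrier R)) where

  open CommutativeRing R
  open BM R _≟_ els hiding (count)

  allᵇ-true : ∀ {A : Set c} (p : A → Bool) xs → (∀ x → p x ≡ true) → allᵇ p xs ≡ true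
  allᵇ-true p []       _      = ≡.refl
  allᵇ-true p (x ∷ xs) p≡true rewrite p≡true x = allᵇ-true p xs p≡true

  allᵇ-false : ∀ {A : Set c} (p : A → Bool) xs → Any (λ x → p x ≡ false) xs → allᵇ p xs ≡ false
  allᵇ-false p (x ∷ xs) (here px≡false) rewrite px≡false = ≡.refl
  allᵇ-false p (x ∷ xs) (there any) with p x
  ... | true  = allᵇ-false p xs any
  ... | false = ≡.refl

  unit : ∀ {n} → Fin n → Vec F n
  unit {suc n} zero    = 1# ∷ Vec.replicate n 0#
  unit         (suc i) = 0# ∷ unit i

  dot-replicate-0 : ∀ {n} (v : Vec F n) → dot v (Vec.replicate n 0#) ≈ 0#
  dot-replicate-0 []      = refl
  dot-replicate-0 (x ∷ v) = trans (+-cong (zeroʳ x) (dot-replicate-0 v)) (+-identityˡ 0#)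

  dot-unit : ∀ {n} (v : Vec F n) i → dot v (unit i) ≈ lookup v i
  dot-unit (x ∷ v) zero    = trans (+-cong (*-identityʳ x) (dot-replicate-0 v)) (+-identityʳ x)
  dot-unit (x ∷ v) (suc i) = trans (+-cong (zeroʳ x) (dot-unit v i)) (+-identityˡ _)

  module FiniteField {q : ℕ} (isFiniteField : IsFiniteFieldOfOrder q) where

    open import Algebra.Definitions.RawSemiring (Semiring.rawSemiring semiring) using () renaming (_^_ to _^ᶠ_)
    open import Algebra.Properties.Semiring.Exp semiring using (^-homo-*)
    open import Relation.Binary.Reasoning.Setoid setoid
    open ListCount using (count; count-complement; EnumeratesOnce; map-enumeratesOnce)

    0≉1 : 0# ≉ 1#
    0≉1 = proj₁ isFiniteField

    inverse : ∀ x → x ≉ 0# → ∃ λ y → x * y ≈ 1#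
    inverse = proj₁ (proj₂ isFiniteField)

    complete : ∀ x → Any (x ≈_) els
    complete = proj₁ (proj₂ (proj₂ isFiniteField))

    distinct : AllPairs _≉_ els
    distinct = proj₁ (proj₂ (proj₂ (proj₂ isFiniteField)))

    length-els : length els ≡ q
    length-els = proj₂ (proj₂ (proj₂ (proj₂ isFiniteField)))

    open DecidedEquivalence isEquivalence _≟_ public using () renaming
      (≐-true to ==-true; ≐-false to ==-false; ≐-sound to ==-sound; ≐-cong to ==-cong;
       ≐-sym to ==-sym; ≐-respˡ to ==-respˡ; ≐-respʳ to ==-respʳ)

    count-none : ∀ z xs → All (_≉ z) xs → count (_== z) xs ≡ 0
    count-none z []       []            = ≡.refl
    count-none z (x ∷ xs) (x≉z ∷ xs≉z) rewrite ==-false x≉z = count-none z xs xs≉z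

    count-once : ∀ z xs → AllPairs _≉_ xs → Any (z ≈_) xs → count (_== z) xs ≡ 1
    count-once z (x ∷ xs) (x≉xs ∷ distinct) z∈ with x ≟ z | z∈
    ... | yes x≈z | _          = ≡.cong suc (count-none z xs (All.map (λ x≉y y≈z → x≉y (trans x≈z (sym y≈z))) x≉xs))
    ... | no  x≉z | here z≈x   = ⊥-elim (x≉z (sym z≈x))
    ... | no  _   | there z∈xs = count-once z xs distinct z∈xs

    els-enumeratesOnce : EnumeratesOnce _==_ els
    els-enumeratesOnce z = count-once z els distinct (complete z)

    inverse-adjoint : ∀ {t s} → t * s ≈ 1# → ∀ x z → (t * x ≈ z ⇔ x ≈ s * z)
    inverse-adjoint {t} {s} ts≈1 x z = mk⇔
      (λ tx≈z → begin
        x            ≈⟨ *-identityˡ x ⟨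
        1# * x       ≈⟨ *-congʳ (trans (sym ts≈1) (*-comm t s)) ⟩
        (s * t) * x  ≈⟨ *-assoc s t x ⟩
        s * (t * x)  ≈⟨ *-congˡ tx≈z ⟩
        s * z        ∎)
      (λ x≈sz → begin
        t * x        ≈⟨ *-congˡ x≈sz ⟩
        t * (s * z)  ≈⟨ *-assoc t s z ⟨
        (t * s) * z  ≈⟨ *-congʳ ts≈1 ⟩
        1# * z       ≈⟨ *-identityˡ z ⟩
        z            ∎)

    zero-product : ∀ {x y} → x ≉ 0# → x * y ≈ 0# → y ≈ 0#
    zero-product {x} {y} x≉0 xy≈0 =
      let (s , xs≈1) = inverse x x≉0 in
      trans (Equivalence.to (inverse-adjoint xs≈1 y 0#) xy≈0) (zeroʳ s)

    *-≉0 : ∀ {x y} → x ≉ 0# → y ≉ 0# → x * y ≉ 0#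
    *-≉0 x≉0 y≉0 xy≈0 = y≉0 (zero-product x≉0 xy≈0)

    scale-enumeratesOnce : ∀ {t} → t ≉ 0# → EnumeratesOnce _==_ (map (t *_) els)
    scale-enumeratesOnce {t} t≉0 =
      let (s , ts≈1) = inverse t t≉0 in
      map-enumeratesOnce (t *_) (s *_) (λ x z → ==-cong (inverse-adjoint ts≈1 x z)) els els-enumeratesOnce

    pow≡^ : ∀ x n → pow x n ≡ x ^ᶠ n
    pow≡^ x zero    = ≡.refl
    pow≡^ x (suc n) = ≡.cong (x *_) (pow≡^ x n)

    pow-+ : ∀ x m n → pow x (m +ℕ n) ≈ pow x m * pow x n
    pow-+ x m n rewrite pow≡^ x (m +ℕ n) | pow≡^ x m | pow≡^ x n = ^-homo-* x m n

    open BigOp *-commutativeMonoid using (∏; ∏-cong; ∏-map; ∏-∙; ∏-if; ∏-reindex; _times_)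

    nonzeroPart : F → F
    nonzeroPart x = if x == 0# then 1# else x

    nonzeroPart-≉0 : ∀ x → nonzeroPart x ≉ 0#
    nonzeroPart-≉0 x with x ≟ 0#
    ... | yes _   = λ 1≈0 → 0≉1 (sym 1≈0)
    ... | no  x≉0 = x≉0

    nonzeroPart-resp : ∀ x y → x == y ≡ true → nonzeroPart x ≈ nonzeroPart y
    nonzeroPart-resp x y x==y with x ≟ 0# | y ≟ 0#
    ... | yes _   | yes _   = refl
    ... | yes x≈0 | no  y≉0 = ⊥-elim (y≉0 (trans (sym (==-sound x==y)) x≈0))
    ... | no  x≉0 | yes y≈0 = ⊥-elim (x≉0 (trans (==-sound x==y) y≈0))
    ... | no  _   | no  _   = ==-sound x==y

    ∏-nonzeroPart-≉0 : ∀ xs → ∏ nonzeroPart xs ≉ 0#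
    ∏-nonzeroPart-≉0 []       1≈0 = 0≉1 (sym 1≈0)
    ∏-nonzeroPart-≉0 (x ∷ xs)     = *-≉0 (nonzeroPart-≉0 x) (∏-nonzeroPart-≉0 xs)

    #units : ℕ
    #units = count (λ x → not (x == 0#)) els

    suc-#units : suc #units ≡ q
    suc-#units = ≡.trans (≡.cong (_+ℕ #units) (≡.sym (els-enumeratesOnce 0#)))
                         (≡.trans (count-complement (_== 0#) els) length-els)

    nonzeroPart-scale : ∀ {t} → t ≉ 0# → ∀ x → nonzeroPart (t * x) ≈ (if not (x == 0#) then t else 1#) * nonzeroPart x
    nonzeroPart-scale {t} t≉0 x with x ≟ 0#
    ... | yes x≈0 rewrite ==-true (trans (*-congˡ x≈0) (zeroʳ t)) = sym (*-identityˡ 1#)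
    ... | no  x≉0 rewrite ==-false (*-≉0 t≉0 x≉0) = refl

    -- The product of all units is invariant under x ↦ t x, which multiplies it by t ^ #units.
    pow-#units : ∀ {t} → t ≉ 0# → pow t #units ≈ 1#
    pow-#units {t} t≉0 = begin
      pow t #units        ≈⟨ Equivalence.to (inverse-adjoint P*P⁻¹≈1 (pow t #units) P) P*tⁿ≈P ⟩
      P⁻¹ * P             ≈⟨ *-comm P⁻¹ P ⟩
      P * P⁻¹             ≈⟨ P*P⁻¹≈1 ⟩
      1#                  ∎
      where
      P = ∏ nonzeroPart els
      P⁻¹ = proj₁ (inverse P (∏-nonzeroPart-≉0 els))
      P*P⁻¹≈1 = proj₂ (inverse P (∏-nonzeroPart-≉0 els))
      P*tⁿ≈P : P * pow t #units ≈ P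
      P*tⁿ≈P = sym (begin
        ∏ nonzeroPart els                                         ≈⟨ ∏-reindex _==_ ==-sym nonzeroPart nonzeroPart-resp els (map (t *_) els)
                                                                       els-enumeratesOnce (scale-enumeratesOnce t≉0) ⟩
        ∏ nonzeroPart (map (t *_) els)                            ≈⟨ ∏-map nonzeroPart (t *_) els ⟩
        ∏ (λ x → nonzeroPart (t * x)) els                         ≈⟨ ∏-cong (nonzeroPart-scale t≉0) els ⟩
        ∏ (λ x → (if not (x == 0#) then t else 1#) * nonzeroPart x) els ≈⟨ ∏-∙ _ nonzeroPart els ⟩
        ∏ (λ x → if not (x == 0#) then t else 1#) els * P         ≈⟨ *-congʳ (∏-if (λ x → not (x == 0#)) t els) ⟩
        (#units times t) * P                                      ≡⟨ ≡.cong (_* P) (≡.sym (pow≡^ t #units)) ⟩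
        pow t #units * P                                          ≈⟨ *-comm _ P ⟩
        P * pow t #units                                          ∎)

    fermat : ∀ t → pow t q ≈ t
    fermat t = ≡.subst (λ n → pow t n ≈ t) suc-#units (fermat′ (t ≟ 0#))
      where
      fermat′ : Dec (t ≈ 0#) → pow t (suc #units) ≈ t
      fermat′ (yes t≈0) = trans (*-congʳ t≈0) (trans (zeroˡ _) (sym t≈0))
      fermat′ (no  t≉0) = trans (*-congˡ (pow-#units t≉0)) (*-identityʳ t)

  module QuadraticExtension (h : ℕ) (isFiniteField : IsFiniteFieldOfOrder (2 ^ h))
    (char2 : 1# + 1# ≈ 0#) (δ : F) (trace≈1 : absTrace h δ ≈ 1#) where

    open Ext δ
    open FiniteField isFiniteField public
    open ListCount using (count; count-true; count-×; count-cong; count-map; EnumeratesOnce; cartesianProduct-enumeratesOnce; map-enumeratesOnce)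
    open CountingSums using (count-reindex; count≡∑; ∑; ∑-cong; ∑-swap; ∑-if)
    open Char2Solver R char2 using (solve; _:=_; con; syntaxRing; _:+_; _:*_; _:-_)
    module Syn {n : ℕ} = Formulas (syntaxRing n)
    module ≈-Reasoning = Relation.Binary.Reasoning.Setoid setoid
    open Setoid (×-setoid setoid setoid) public using ()
      renaming (refl to ≈₂-refl; reflexive to ≈₂-reflexive; sym to ≈₂-sym; trans to ≈₂-trans)
    open Setoid (×-setoid setoid setoid) using () renaming (isEquivalence to ≈₂-isEquivalence)

    _≟₂_ : Decidable _≈₂_
    x ≟₂ y = (proj₁ x ≟ proj₁ y) ×-dec (proj₂ x ≟ proj₂ y)

    open DecidedEquivalence ≈₂-isEquivalence _≟₂_ public using () renaming
      (≐-true to ==₂-true; ≐-false to ==₂-false; ≐-sound to ==₂-sound;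
       ≐-sym to ==₂-sym; ≐-respˡ to ==₂-respˡ; ≐-respʳ to ==₂-respʳ)

    module ≈₂-Reasoning = Relation.Binary.Reasoning.Setoid (×-setoid setoid setoid)

    q : ℕ
    q = 2 ^ h

    Nm : F2 → F
    Nm = Formulas.norm rawRing δ

    x+x≈0 : ∀ x → x + x ≈ 0#
    x+x≈0 x = trans (solve 1 (λ x → x :+ x := (con true :+ con true) :* x) refl x) (trans (*-congʳ char2) (zeroˡ x))

    +≈0⇔≈ : ∀ {x y} → x + y ≈ 0# ⇔ x ≈ y
    +≈0⇔≈ {x} {y} = mk⇔
      (λ x+y≈0 → begin
        x              ≈⟨ solve 2 (λ x y → x := (x :+ y) :+ y) refl x y ⟩
        (x + y) + y    ≈⟨ +-congʳ x+y≈0 ⟩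
        0# + y         ≈⟨ +-identityˡ y ⟩
        y              ∎)
      (λ x≈y → trans (+-congʳ x≈y) (x+x≈0 y))
      where open ≈-Reasoning

    ⊕-cong : ∀ {x y u v} → x ≈₂ y → u ≈₂ v → (x ⊕ u) ≈₂ (y ⊕ v)
    ⊕-cong (x0≈y0 , x1≈y1) (u0≈v0 , u1≈v1) = +-cong x0≈y0 u0≈v0 , +-cong x1≈y1 u1≈v1

    ⊖-cong : ∀ {x y u v} → x ≈₂ y → u ≈₂ v → (x ⊖ u) ≈₂ (y ⊖ v)
    ⊖-cong (x0≈y0 , x1≈y1) (u0≈v0 , u1≈v1) = +-cong x0≈y0 (-‿cong u0≈v0) , +-cong x1≈y1 (-‿cong u1≈v1)

    ⊗-cong : ∀ {x y u v} → x ≈₂ y → u ≈₂ v → (x ⊗ u) ≈₂ (y ⊗ v)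
    ⊗-cong (x0≈y0 , x1≈y1) (u0≈v0 , u1≈v1) =
      +-cong (*-cong x0≈y0 u0≈v0) (-‿cong (*-congˡ (*-cong x1≈y1 u1≈v1))) ,
      +-cong (+-cong (*-cong x0≈y0 u1≈v1) (*-cong x1≈y1 u0≈v0)) (-‿cong (*-cong x1≈y1 u1≈v1))

    ⊗-assoc : ∀ x y z → ((x ⊗ y) ⊗ z) ≈₂ (x ⊗ (y ⊗ z))
    ⊗-assoc (x0 , x1) (y0 , y1) (z0 , z1) =
      solve 7 (λ x0 x1 y0 y1 z0 z1 d → proj₁ (Syn.mul d (Syn.mul d (x0 , x1) (y0 , y1)) (z0 , z1))
                                    := proj₁ (Syn.mul d (x0 , x1) (Syn.mul d (y0 , y1) (z0 , z1)))) refl x0 x1 y0 y1 z0 z1 δ ,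
      solve 7 (λ x0 x1 y0 y1 z0 z1 d → proj₂ (Syn.mul d (Syn.mul d (x0 , x1) (y0 , y1)) (z0 , z1))
                                    := proj₂ (Syn.mul d (x0 , x1) (Syn.mul d (y0 , y1) (z0 , z1)))) refl x0 x1 y0 y1 z0 z1 δ

    ⊗-identityˡ : ∀ x → (1₂ ⊗ x) ≈₂ x
    ⊗-identityˡ (x0 , x1) =
      solve 3 (λ x0 x1 d → proj₁ (Syn.mul d (con true , con false) (x0 , x1)) := x0) refl x0 x1 δ ,
      solve 3 (λ x0 x1 d → proj₂ (Syn.mul d (con true , con false) (x0 , x1)) := x1) refl x0 x1 δ

    ⊗-identityʳ : ∀ x → (x ⊗ 1₂) ≈₂ x
    ⊗-identityʳ (x0 , x1) =
      solve 3 (λ x0 x1 d → proj₁ (Syn.mul d (x0 , x1) (con true , con false)) := x0) refl x0 x1 δ ,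
      solve 3 (λ x0 x1 d → proj₂ (Syn.mul d (x0 , x1) (con true , con false)) := x1) refl x0 x1 δ

    ⊗-distribˡ-⊕ : ∀ x y z → (x ⊗ (y ⊕ z)) ≈₂ ((x ⊗ y) ⊕ (x ⊗ z))
    ⊗-distribˡ-⊕ (x0 , x1) (y0 , y1) (z0 , z1) =
      solve 7 (λ x0 x1 y0 y1 z0 z1 d → proj₁ (Syn.mul d (x0 , x1) (Syn.add (y0 , y1) (z0 , z1)))
                                    := proj₁ (Syn.add (Syn.mul d (x0 , x1) (y0 , y1)) (Syn.mul d (x0 , x1) (z0 , z1)))) refl x0 x1 y0 y1 z0 z1 δ ,
      solve 7 (λ x0 x1 y0 y1 z0 z1 d → proj₂ (Syn.mul d (x0 , x1) (Syn.add (y0 , y1) (z0 , z1)))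
                                    := proj₂ (Syn.add (Syn.mul d (x0 , x1) (y0 , y1)) (Syn.mul d (x0 , x1) (z0 , z1)))) refl x0 x1 y0 y1 z0 z1 δ

    pow₂-+ : ∀ x m n → pow₂ x (m +ℕ n) ≈₂ (pow₂ x m ⊗ pow₂ x n)
    pow₂-+ x zero    n = ≈₂-sym (⊗-identityˡ _)
    pow₂-+ x (suc m) n = ≈₂-trans (⊗-cong (≈₂-refl {x}) (pow₂-+ x m n)) (≈₂-sym (⊗-assoc x _ _))

    pow-double : ∀ x n → pow x (2 *ℕ n) ≈ pow x n * pow x n
    pow-double x n = trans (pow-+ x n (n +ℕ 0)) (*-congˡ (reflexive (≡.cong (pow x) (+ℕ-identityʳ n))))

    pow₂-double : ∀ x n → pow₂ x (2 *ℕ n) ≈₂ (pow₂ x n ⊗ pow₂ x n)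
    pow₂-double x n =
      ≈₂-trans (pow₂-+ x n (n +ℕ 0)) (⊗-cong (≈₂-refl {pow₂ x n}) (≈₂-reflexive (≡.cong (pow₂ x) (+ℕ-identityʳ n))))

    absTrace-suc : ∀ i → absTrace (suc i) δ ≈ δ + absTrace i δ * absTrace i δ
    absTrace-suc zero    = solve 1 (λ d → con false :+ d :* con true := d :+ con false :* con false) refl δ
    absTrace-suc (suc i) = begin
      absTrace (suc i) δ + pow δ (2 ^ suc i) ≈⟨ +-cong (absTrace-suc i) (pow-double δ (2 ^ i)) ⟩
      (δ + T * T) + D * D                    ≈⟨ solve 3 (λ d t e → (d :+ t :* t) :+ e :* e := d :+ (t :+ e) :* (t :+ e)) refl δ T D ⟩
      δ + (T + D) * (T + D)                  ∎
      where
      open ≈-Reasoning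
      T = absTrace i δ
      D = pow δ (2 ^ i)

    -- ε ^ (2 ^ i) = ε + absTrace i δ.
    frobenius-iterate : ∀ i x → pow₂ x (2 ^ i) ≈₂ (pow (proj₁ x) (2 ^ i) + absTrace i δ * pow (proj₂ x) (2 ^ i) , pow (proj₂ x) (2 ^ i))
    frobenius-iterate zero (x0 , x1) =
      solve 3 (λ x0 x1 d → proj₁ (Syn.mul d (x0 , x1) (con true , con false)) := x0 :* con true :+ con false :* (x1 :* con true)) refl x0 x1 δ ,
      solve 3 (λ x0 x1 d → proj₂ (Syn.mul d (x0 , x1) (con true , con false)) := x1 :* con true) refl x0 x1 δ
    frobenius-iterate (suc i) x@(x0 , x1) = begin
      pow₂ x (2 ^ suc i)                                ≈⟨ pow₂-double x (2 ^ i) ⟩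
      pow₂ x (2 ^ i) ⊗ pow₂ x (2 ^ i)                   ≈⟨ ⊗-cong (frobenius-iterate i x) (frobenius-iterate i x) ⟩
      (A + T * B , B) ⊗ (A + T * B , B)                 ≈⟨ square ⟩
      (A * A + (δ + T * T) * (B * B) , B * B)           ≈⟨ +-cong (pow-double x0 (2 ^ i)) (*-cong (absTrace-suc i) (pow-double x1 (2 ^ i))) ,
                                                           pow-double x1 (2 ^ i) ⟨
      (pow x0 (2 ^ suc i) + absTrace (suc i) δ * pow x1 (2 ^ suc i) , pow x1 (2 ^ suc i)) ∎
      where
      open ≈₂-Reasoning
      A = pow x0 (2 ^ i)
      B = pow x1 (2 ^ i)
      T = absTrace i δ
      square : ((A + T * B , B) ⊗ (A + T * B , B)) ≈₂ (A * A + (δ + T * T) * (B * B) , B * B)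
      square =
        solve 4 (λ a b t d → proj₁ (Syn.mul d (a :+ t :* b , b) (a :+ t :* b , b)) := a :* a :+ (d :+ t :* t) :* (b :* b)) refl A B T δ ,
        solve 4 (λ a b t d → proj₂ (Syn.mul d (a :+ t :* b , b) (a :+ t :* b , b)) := b :* b) refl A B T δ

    frobenius : ∀ x → pow₂ x q ≈₂ (proj₁ x + proj₂ x , proj₂ x)
    frobenius x@(x0 , x1) = ≈₂-trans (frobenius-iterate h x)
      (+-cong (fermat x0) (trans (*-cong trace≈1 (fermat x1)) (*-identityˡ x1)) , fermat x1)

    pow₂-suc-q : ∀ x → pow₂ x (suc q) ≈₂ (Nm x , 0#)
    pow₂-suc-q x@(x0 , x1) = ≈₂-trans (⊗-cong (≈₂-refl {x}) (frobenius x))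
      (solve 3 (λ x0 x1 d → proj₁ (Syn.mul d (x0 , x1) (x0 :+ x1 , x1)) := Syn.norm d (x0 , x1)) refl x0 x1 δ ,
       solve 3 (λ x0 x1 d → proj₂ (Syn.mul d (x0 , x1) (x0 :+ x1 , x1)) := con false) refl x0 x1 δ)

    Nm-cong : ∀ {x y} → x ≈₂ y → Nm x ≈ Nm y
    Nm-cong (x0≈y0 , x1≈y1) = +-cong (+-cong (*-cong x0≈y0 x0≈y0) (*-cong x0≈y0 x1≈y1)) (*-congˡ (*-cong x1≈y1 x1≈y1))

    Nm-0 : Nm 0₂ ≈ 0#
    Nm-0 = solve 1 (λ d → Syn.norm d (con false , con false) := con false) refl δ

    Nm-1 : Nm 1₂ ≈ 1#
    Nm-1 = solve 1 (λ d → Syn.norm d (con true , con false) := con true) refl δ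

    Nm-⊗ : ∀ x y → Nm (x ⊗ y) ≈ Nm x * Nm y
    Nm-⊗ (x0 , x1) (y0 , y1) =
      solve 5 (λ x0 x1 y0 y1 d → Syn.norm d (Syn.mul d (x0 , x1) (y0 , y1)) := Syn.norm d (x0 , x1) :* Syn.norm d (y0 , y1))
        refl x0 x1 y0 y1 δ

    _·₂_ : F → F2 → F2
    s ·₂ x = s * proj₁ x , s * proj₂ x

    Nm-scale : ∀ s x → Nm (s ·₂ x) ≈ (s * s) * Nm x
    Nm-scale s (x0 , x1) =
      solve 4 (λ s x0 x1 d → Syn.norm d (s :* x0 , s :* x1) := (s :* s) :* Syn.norm d (x0 , x1)) refl s x0 x1 δ

    -- A root t would make w = t + ε idempotent, hence fixed by x ↦ x ^ q, which sends it to w + 1.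
    x²+x+δ≉0 : ∀ t → t * t + t + δ ≉ 0#
    x²+x+δ≉0 t root = 0≉1 (begin
      0#             ≈⟨ x+x≈0 t ⟨
      t + t          ≈⟨ +-congˡ (proj₁ w≈w+1) ⟩
      t + (t + 1#)   ≈⟨ solve 1 (λ t → t :+ (t :+ con true) := con true) refl t ⟩
      1#             ∎)
      where
      open ≈-Reasoning
      w : F2
      w = t , 1#
      w²≈w : (w ⊗ w) ≈₂ w
      w²≈w = (begin
          t * t - δ * (1# * 1#)  ≈⟨ solve 2 (λ t d → t :* t :- d :* (con true :* con true) := (t :* t :+ t :+ d) :+ t) refl t δ ⟩
          (t * t + t + δ) + t    ≈⟨ +-congʳ root ⟩
          0# + t                 ≈⟨ +-identityˡ t ⟩
          t                      ∎) ,
        solve 1 (λ t → (t :* con true :+ con true :* t) :- con true :* con true := con true) refl t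
      pow₂-w : ∀ i → pow₂ w (2 ^ i) ≈₂ w
      pow₂-w zero    = ⊗-identityʳ w
      pow₂-w (suc i) = ≈₂-trans (pow₂-double w (2 ^ i)) (≈₂-trans (⊗-cong (pow₂-w i) (pow₂-w i)) w²≈w)
      w≈w+1 : w ≈₂ (t + 1# , 1#)
      w≈w+1 = ≈₂-trans (≈₂-sym (pow₂-w h)) (frobenius w)

    Nm-anisotropic : ∀ x → Nm x ≈ 0# → x ≈₂ 0₂
    Nm-anisotropic x@(x0 , x1) Nx≈0 with x1 ≟ 0#
    ... | yes x1≈0 = x0≈0 , x1≈0
      where
      open ≈-Reasoning
      x0²≈0 : x0 * x0 ≈ 0#
      x0²≈0 = begin
        x0 * x0                    ≈⟨ solve 3 (λ x0 x1 d → x0 :* x0 := Syn.norm d (x0 , x1) :+ x1 :* (x0 :+ d :* x1)) refl x0 x1 δ ⟩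
        Nm x + x1 * (x0 + δ * x1)  ≈⟨ +-cong Nx≈0 (trans (*-congʳ x1≈0) (zeroˡ _)) ⟩
        0# + 0#                    ≈⟨ +-identityˡ 0# ⟩
        0#                         ∎
      x0≈0 : x0 ≈ 0#
      x0≈0 with x0 ≟ 0#
      ... | yes x0≈0 = x0≈0
      ... | no  x0≉0 = ⊥-elim (*-≉0 x0≉0 x0≉0 x0²≈0)
    ... | no x1≉0 = ⊥-elim (x²+x+δ≉0 t root)
      where
      open ≈-Reasoning
      s = proj₁ (inverse x1 x1≉0)
      t = s * x0
      root : t * t + t + δ ≈ 0#
      root = begin
        t * t + t + δ                   ≈⟨ solve 2 (λ t d → t :* t :+ t :+ d := Syn.norm d (t , con true)) refl t δ ⟩
        Nm (t , 1#)                     ≈⟨ Nm-cong (refl , trans (sym (proj₂ (inverse x1 x1≉0))) (*-comm x1 s)) ⟩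
        Nm (s * x0 , s * x1)            ≈⟨ Nm-scale s x ⟩
        (s * s) * Nm x                  ≈⟨ *-congˡ Nx≈0 ⟩
        (s * s) * 0#                    ≈⟨ zeroʳ _ ⟩
        0#                              ∎

    ⊗-≉0 : ∀ {x y} → ¬ (x ≈₂ 0₂) → ¬ (y ≈₂ 0₂) → ¬ ((x ⊗ y) ≈₂ 0₂)
    ⊗-≉0 {x} {y} x≉0 y≉0 xy≈0 =
      *-≉0 (λ Nx≈0 → x≉0 (Nm-anisotropic x Nx≈0)) (λ Ny≈0 → y≉0 (Nm-anisotropic y Ny≈0))
        (trans (sym (Nm-⊗ x y)) (trans (Nm-cong xy≈0) Nm-0))

    els₂-enumeratesOnce : EnumeratesOnce _==₂_ els₂
    els₂-enumeratesOnce = cartesianProduct-enumeratesOnce els els els-enumeratesOnce els-enumeratesOnce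

    complete₂ : ∀ z → Any (z ≈₂_) els₂
    complete₂ (z0 , z1) = cartesianProduct⁺ (complete z0) (complete z1)

    length-els₂ : length els₂ ≡ q *ℕ q
    length-els₂ = ≡.trans (≡.sym (count-true els₂))
      (≡.trans (count-× (λ _ → true) (λ _ → true) els els)
        (≡.cong₂ _*ℕ_ (≡.trans (count-true els) length-els) (≡.trans (count-true els) length-els)))

    ·₂-enumeratesOnce : ∀ {s} → s ≉ 0# → EnumeratesOnce _==₂_ (map (s ·₂_) els₂)
    ·₂-enumeratesOnce {s} s≉0 = map-enumeratesOnce (s ·₂_) (s⁻¹ ·₂_) adjoint els₂ els₂-enumeratesOnce
      where
      s⁻¹ = proj₁ (inverse s s≉0)
      adjoint : ∀ y z → (s ·₂ y) ==₂ z ≡ y ==₂ (s⁻¹ ·₂ z)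
      adjoint y z = ≡.cong₂ _∧_ (==-cong (inverse-adjoint (proj₂ (inverse s s≉0)) (proj₁ y) (proj₁ z)))
                                (==-cong (inverse-adjoint (proj₂ (inverse s s≉0)) (proj₂ y) (proj₂ z)))

    Nm==0≡==₂0 : ∀ y → Nm y == 0# ≡ y ==₂ 0₂
    Nm==0≡==₂0 y = does-⇔ (mk⇔ (Nm-anisotropic y) (λ y≈0 → trans (Nm-cong y≈0) Nm-0)) (Nm y ≟ 0#) (y ≟₂ 0₂)

    ∑-Nm-fibres : ∑ (λ c → count (λ y → Nm y == c) els₂) els ≡ q *ℕ q
    ∑-Nm-fibres = begin
      ∑ (λ c → count (λ y → Nm y == c) els₂) els               ≡⟨ ∑-cong (λ c → count≡∑ (λ y → Nm y == c) els₂) els ⟩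
      ∑ (λ c → ∑ (λ y → if Nm y == c then 1 else 0) els₂) els  ≡⟨ ∑-swap (λ c y → if Nm y == c then 1 else 0) els els₂ ⟩
      ∑ (λ y → ∑ (λ c → if Nm y == c then 1 else 0) els) els₂  ≡⟨ ∑-cong (λ y → count≡∑ (Nm y ==_) els) els₂ ⟨
      ∑ (λ y → count (Nm y ==_) els) els₂                      ≡⟨ ∑-cong Nm-hits-once els₂ ⟩
      ∑ (λ _ → 1) els₂                                         ≡⟨ count≡∑ (λ _ → true) els₂ ⟨
      count (λ _ → true) els₂                                  ≡⟨ count-true els₂ ⟩
      length els₂                                              ≡⟨ length-els₂ ⟩
      q *ℕ q                                                   ∎
      where
      open ≡.≡-Reasoning
      Nm-hits-once : ∀ y → count (Nm y ==_) els ≡ 1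
      Nm-hits-once y = ≡.trans (count-cong (==-sym (Nm y)) els) (els-enumeratesOnce (Nm y))

    module _ {h′ : ℕ} (h≡suc : h ≡ suc h′) where

      square-root : ∀ c → pow c (2 ^ h′) * pow c (2 ^ h′) ≈ c
      square-root c = trans (sym (pow-double c (2 ^ h′))) (≡.subst (λ k → pow c (2 ^ k) ≈ c) h≡suc (fermat c))

      Nm-fibre-≉0 : ∀ {c} → c ≉ 0# → count (λ y → Nm y == c) els₂ ≡ count (λ y → Nm y == 1#) els₂
      Nm-fibre-≉0 {c} c≉0 = begin
        count (λ y → Nm y == c) els₂                ≡⟨ count-reindex _==₂_ ==₂-sym (λ y → Nm y == c) Nm==c-resp
                                                         els₂ (map (s ·₂_) els₂) els₂-enumeratesOnce (·₂-enumeratesOnce s≉0) ⟩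
        count (λ y → Nm y == c) (map (s ·₂_) els₂)  ≡⟨ count-map (λ y → Nm y == c) (s ·₂_) els₂ ⟩
        count (λ y → Nm (s ·₂ y) == c) els₂         ≡⟨ count-cong Nm-s·y==c els₂ ⟩
        count (λ y → Nm y == 1#) els₂               ∎
        where
        open ≡.≡-Reasoning
        s = pow c (2 ^ h′)
        s≉0 : s ≉ 0#
        s≉0 s≈0 = c≉0 (trans (sym (square-root c)) (trans (*-congʳ s≈0) (zeroˡ s)))
        c⁻¹ = proj₁ (inverse c c≉0)
        Nm==c-resp : ∀ x y → x ==₂ y ≡ true → Nm x == c ≡ Nm y == c
        Nm==c-resp x y x==y = ==-respˡ c (Nm-cong (==₂-sound x==y))
        Nm-s·y==c : ∀ y → Nm (s ·₂ y) == c ≡ Nm y == 1#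
        Nm-s·y==c y = begin
          Nm (s ·₂ y) == c   ≡⟨ ==-respˡ c (trans (Nm-scale s y) (*-congʳ (square-root c))) ⟩
          (c * Nm y) == c    ≡⟨ ==-cong (inverse-adjoint (proj₂ (inverse c c≉0)) (Nm y) c) ⟩
          Nm y == (c⁻¹ * c)  ≡⟨ ==-respʳ (Nm y) (trans (*-comm c⁻¹ c) (proj₂ (inverse c c≉0))) ⟩
          Nm y == 1#         ∎

      Nm-fibre-0 : count (λ y → Nm y == 0#) els₂ ≡ 1
      Nm-fibre-0 = ≡.trans (count-cong Nm==0≡==₂0 els₂) (els₂-enumeratesOnce 0₂)

      -- Summing the fibre sizes over F_q gives 1 + k (q - 1) = q².
      Nm-fibre-1 : count (λ y → Nm y == 1#) els₂ ≡ suc q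
      Nm-fibre-1 = ≡.trans (ℕ-cancel k #units (begin
          1 +ℕ k *ℕ #units                          ≡⟨ ≡.cong (_+ℕ k *ℕ #units) (≡.trans (*ℕ-identityˡ _) (els-enumeratesOnce 0#)) ⟨
          1 *ℕ count (_== 0#) els +ℕ k *ℕ #units    ≡⟨ ∑-if (_== 0#) 1 k els ⟨
          ∑ (λ c → if c == 0# then 1 else k) els    ≡⟨ ∑-cong fibre-size els ⟨
          ∑ (λ c → count (λ y → Nm y == c) els₂) els ≡⟨ ∑-Nm-fibres ⟩
          q *ℕ q                                    ≡⟨ ≡.cong₂ _*ℕ_ suc-#units suc-#units ⟨
          suc #units *ℕ suc #units                  ∎)) (≡.cong suc suc-#units)
        where
        open ≡.≡-Reasoning
        k = count (λ y → Nm y == 1#) els₂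
        fibre-size : ∀ c → count (λ y → Nm y == c) els₂ ≡ (if c == 0# then 1 else k)
        fibre-size c with c ≟ 0#
        ... | yes c≈0 = ≡.trans (count-cong (λ y → ==-respʳ (Nm y) c≈0) els₂) Nm-fibre-0
        ... | no  c≉0 = Nm-fibre-≉0 c≉0
        instance
          #units-nonZero : NonZero #units
          #units-nonZero = >-nonZero (s≤s⁻¹ (≡.subst (2 ≤_) (≡.sym (≡.trans suc-#units (≡.cong (2 ^_) h≡suc)))
                                                       (*-monoʳ-≤ 2 (m^n>0 2 h′))))
        ℕ-cancel : ∀ k n → .{{NonZero n}} → 1 +ℕ k *ℕ n ≡ suc n *ℕ suc n → k ≡ suc (suc n)
        ℕ-cancel k n eq = *-cancelʳ-≡ k (suc (suc n)) n (≡.trans (suc-injective eq) (≡.cong (n +ℕ_) (*-suc n n)))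

  module Cone (char2 : 1# + 1# ≈ 0#) (δ a0 a1 b1 b1⁻¹ : F) (b1*b1⁻¹≈1 : b1 * b1⁻¹ ≈ 1#) where

    open Ext δ using (Q7)
    open Char2Solver R char2 using (solve; prove; _:=_; con; var; Polynomial; syntaxRing; _:+_; _:*_; _:-_)
    module Syn {n : ℕ} = Formulas (syntaxRing n)
    open Relation.Binary.Reasoning.Setoid setoid

    Q : Vec F 7 → F
    Q = Q7 a0 a1 b1

    b1-cancel : ∀ {x} → b1 * x ≈ 0# → x ≈ 0#
    b1-cancel {x} b1x≈0 = begin
      x                 ≈⟨ *-identityˡ x ⟨
      1# * x            ≈⟨ *-congʳ (trans (sym b1*b1⁻¹≈1) (*-comm b1 b1⁻¹)) ⟩
      (b1⁻¹ * b1) * x   ≈⟨ *-assoc b1⁻¹ b1 x ⟩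
      b1⁻¹ * (b1 * x)   ≈⟨ *-congˡ b1x≈0 ⟩
      b1⁻¹ * 0#         ≈⟨ zeroʳ b1⁻¹ ⟩
      0#                ∎

    polarCoefficients : Vec F 7 → Vec F 7
    polarCoefficients = Formulas.polarCoefficients rawRing b1

    polar-Q : ∀ w u → polar Q w u ≈ dot (polarCoefficients w) u
    polar-Q (w0 ∷ w1 ∷ w2 ∷ w3 ∷ w4 ∷ w5 ∷ w6 ∷ []) (u0 ∷ u1 ∷ u2 ∷ u3 ∷ u4 ∷ u5 ∷ u6 ∷ []) =
      solve 18 (λ w0 w1 w2 w3 w4 w5 w6 u0 u1 u2 u3 u4 u5 u6 a0 a1 b1 d →
        let w = w0 ∷ w1 ∷ w2 ∷ w3 ∷ w4 ∷ w5 ∷ w6 ∷ []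
            u = u0 ∷ u1 ∷ u2 ∷ u3 ∷ u4 ∷ u5 ∷ u6 ∷ []
        in Syn.q7 a0 a1 b1 d (Vec.zipWith _:+_ w u) :- Syn.q7 a0 a1 b1 d w :- Syn.q7 a0 a1 b1 d u
           := Syn.dot (Syn.polarCoefficients b1 w) u)
        refl w0 w1 w2 w3 w4 w5 w6 u0 u1 u2 u3 u4 u5 u6 a0 a1 b1 δ

    radical-coefficients : ∀ w → (∀ u → polar Q w u ≈ 0#) → ∀ i → lookup (polarCoefficients w) i ≈ 0#
    radical-coefficients w w-radical i = begin
      lookup (polarCoefficients w) i      ≈⟨ dot-unit (polarCoefficients w) i ⟨
      dot (polarCoefficients w) (unit i)  ≈⟨ polar-Q w (unit i) ⟨
      polar Q w (unit i)                  ≈⟨ w-radical (unit i) ⟩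
      0#                                  ∎

    vertex : HasVertex Q vertexV
    vertex = (Q-V≈0 , V-radical) , radical⊆V
      where
      Q-V≈0 : Q vertexV ≈ 0#
      Q-V≈0 = solve 4 (λ a0 a1 b1 d → Syn.q7 a0 a1 b1 d (con false ∷ con false ∷ con false ∷ con false ∷ con false ∷ con true ∷ con false ∷ [])
                                    := con false) refl a0 a1 b1 δ
      V-radical : ∀ u → polar Q vertexV u ≈ 0#
      V-radical u@(u0 ∷ u1 ∷ u2 ∷ u3 ∷ u4 ∷ u5 ∷ u6 ∷ []) = trans (polar-Q vertexV u)
        (solve 8 (λ u0 u1 u2 u3 u4 u5 u6 b1 →
           Syn.dot (Syn.polarCoefficients b1 (con false ∷ con false ∷ con false ∷ con false ∷ con false ∷ con true ∷ con false ∷ []))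
                   (u0 ∷ u1 ∷ u2 ∷ u3 ∷ u4 ∷ u5 ∷ u6 ∷ []) := con false) refl u0 u1 u2 u3 u4 u5 u6 b1)
      radical⊆V : ∀ w → Q w ≈ 0# → (∀ u → polar Q w u ≈ 0#) → ∃ λ t → w ≈v scale t vertexV
      radical⊆V w@(w0 ∷ w1 ∷ w2 ∷ w3 ∷ w4 ∷ w5 ∷ w6 ∷ []) _ w-radical =
        w5 , (≈0 (κ (# 6)) ∷ ≈0 (b1-cancel (κ (# 2))) ∷ ≈0 (b1-cancel (κ (# 1))) ∷ ≈0 (b1-cancel (κ (# 4)))
                ∷ ≈0 (b1-cancel (κ (# 3))) ∷ sym (*-identityʳ w5) ∷ ≈0 (κ (# 0)) ∷ [])
        where
        κ = radical-coefficients w w-radical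
        ≈0 : ∀ {x} → x ≈ 0# → x ≈ w5 * 0#
        ≈0 x≈0 = trans x≈0 (sym (zeroʳ w5))

    A B : F
    A = a1 + b1
    B = a0 + a1 + δ * a1 + δ * b1

    M N : Vec (Vec F 6) 6
    M = Formulas.frame rawRing b1 A B
    N = Formulas.coframe rawRing b1⁻¹ A B

    module FrameSyntax where
      v′ : Vec (Polynomial 10) 6
      v′ = var (# 0) ∷ var (# 1) ∷ var (# 2) ∷ var (# 3) ∷ var (# 4) ∷ var (# 5) ∷ []
      b1′ b1⁻¹′ A′ B′ b1b1⁻¹+1 : Polynomial 10
      b1′ = var (# 6)
      b1⁻¹′ = var (# 7)
      A′ = var (# 8)
      B′ = var (# 9)
      b1b1⁻¹+1 = b1′ :* b1⁻¹′ :+ con true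
      MNv NMv : Vec (Polynomial 10) 6
      MNv = Syn.matVec (Syn.frame b1′ A′ B′) (Syn.matVec (Syn.coframe b1⁻¹′ A′ B′) v′)
      NMv = Syn.matVec (Syn.coframe b1⁻¹′ A′ B′) (Syn.matVec (Syn.frame b1′ A′ B′) v′)

    ≈-mod-b1b1⁻¹ : ∀ {l t H} → l ≈ t + (b1 * b1⁻¹ + 1#) * H → l ≈ t
    ≈-mod-b1b1⁻¹ {l} {t} {H} l≈ = begin
      l                            ≈⟨ l≈ ⟩
      t + (b1 * b1⁻¹ + 1#) * H     ≈⟨ +-congˡ (*-congʳ (+-congʳ b1*b1⁻¹≈1)) ⟩
      t + (1# + 1#) * H            ≈⟨ +-congˡ (*-congʳ char2) ⟩
      t + 0# * H                   ≈⟨ +-congˡ (zeroˡ H) ⟩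
      t + 0#                       ≈⟨ +-identityʳ t ⟩
      t                            ∎

    -- Each coordinate differs from the expected one by an explicit multiple of b1 b1⁻¹ + 1 = 0.
    M∘N≈id : ∀ v → matVec M (matVec N v) ≈v v
    M∘N≈id (v0 ∷ v1 ∷ v2 ∷ v3 ∷ v4 ∷ v5 ∷ []) =
        ≈-mod-b1b1⁻¹ (prove ρ (lookup MNv (# 0)) (var (# 0) :+ b1b1⁻¹+1 :* (b1b1⁻¹+1 :* var (# 0))) refl)
      ∷ ≈-mod-b1b1⁻¹ (prove ρ (lookup MNv (# 1)) (var (# 1) :+ b1b1⁻¹+1 :* (var (# 1) :+ var (# 3))) refl)
      ∷ ≈-mod-b1b1⁻¹ (prove ρ (lookup MNv (# 2)) (var (# 2) :+ b1b1⁻¹+1 :* con false) refl)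
      ∷ ≈-mod-b1b1⁻¹ (prove ρ (lookup MNv (# 3)) (var (# 3) :+ b1b1⁻¹+1 :* con false) refl)
      ∷ ≈-mod-b1b1⁻¹ (prove ρ (lookup MNv (# 4)) (var (# 4) :+ b1b1⁻¹+1 :* (var (# 2) :+ var (# 4))) refl)
      ∷ ≈-mod-b1b1⁻¹ (prove ρ (lookup MNv (# 5)) (var (# 5) :+ b1b1⁻¹+1 :* con false) refl)
      ∷ []
      where
      open FrameSyntax
      ρ = v0 ∷ v1 ∷ v2 ∷ v3 ∷ v4 ∷ v5 ∷ b1 ∷ b1⁻¹ ∷ A ∷ B ∷ []

    N∘M≈id : ∀ v → matVec N (matVec M v) ≈v v
    N∘M≈id (v0 ∷ v1 ∷ v2 ∷ v3 ∷ v4 ∷ v5 ∷ []) =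
        ≈-mod-b1b1⁻¹ (prove ρ (lookup NMv (# 0)) (var (# 0) :+ b1b1⁻¹+1 :* (b1b1⁻¹+1 :* var (# 0))) refl)
      ∷ ≈-mod-b1b1⁻¹ (prove ρ (lookup NMv (# 1)) (var (# 1) :+ b1b1⁻¹+1 :* con false) refl)
      ∷ ≈-mod-b1b1⁻¹ (prove ρ (lookup NMv (# 2)) (var (# 2) :+ b1b1⁻¹+1 :* (B′ :* var (# 3))) refl)
      ∷ ≈-mod-b1b1⁻¹ (prove ρ (lookup NMv (# 3)) (var (# 3) :+ b1b1⁻¹+1 :* var (# 3)) refl)
      ∷ ≈-mod-b1b1⁻¹ (prove ρ (lookup NMv (# 4)) (var (# 4) :+ b1b1⁻¹+1 :* (A′ :* var (# 5))) refl)
      ∷ ≈-mod-b1b1⁻¹ (prove ρ (lookup NMv (# 5)) (var (# 5) :+ b1b1⁻¹+1 :* var (# 5)) refl)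
      ∷ []
      where
      open FrameSyntax
      ρ = v0 ∷ v1 ∷ v2 ∷ v3 ∷ v4 ∷ v5 ∷ b1 ∷ b1⁻¹ ∷ A ∷ B ∷ []

    base-in-frame : ∀ v → baseOf Q (matVec M v) ≈ (b1 * b1) * hypForm v
    base-in-frame (v0 ∷ v1 ∷ v2 ∷ v3 ∷ v4 ∷ v5 ∷ []) =
      solve 10 (λ v0 v1 v2 v3 v4 v5 a0 a1 b1 d →
        let x = Syn.matVec (Syn.frame b1 (a1 :+ b1) (a0 :+ a1 :+ d :* a1 :+ d :* b1)) (v0 ∷ v1 ∷ v2 ∷ v3 ∷ v4 ∷ v5 ∷ [])
        in Syn.q7 a0 a1 b1 d (lookup x (# 0) ∷ lookup x (# 1) ∷ lookup x (# 2) ∷ lookup x (# 3) ∷ lookup x (# 4) ∷ con false ∷ lookup x (# 5) ∷ [])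
           := (b1 :* b1) :* (v0 :* v1 :+ v2 :* v3 :+ v4 :* v5))
        refl v0 v1 v2 v3 v4 v5 a0 a1 b1 δ

    base-hyperbolic : b1 ≉ 0# → IsHyperbolic (baseOf Q)
    base-hyperbolic b1≉0 = M , N , M∘N≈id , N∘M≈id , b1 * b1 , b1²≉0 , base-in-frame
      where
      b1²≉0 : b1 * b1 ≉ 0#
      b1²≉0 b1²≈0 = b1≉0 (b1-cancel b1²≈0)

  module BMVariety (h : ℕ) (isFiniteField : IsFiniteFieldOfOrder (2 ^ h))
    (char2 : 1# + 1# ≈ 0#) (δ : F) (trace≈1 : absTrace h δ ≈ 1#)
    (a0 a1 b0 b1 : F) (a≉0 : ¬ (a0 ≈ 0# × a1 ≈ 0#)) (b1≉0 : b1 ≉ 0#) where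

    open Ext δ
    open QuadraticExtension h isFiniteField char2 δ trace≈1
    open Cone char2 δ a0 a1 b1 (proj₁ (inverse b1 b1≉0)) (proj₂ (inverse b1 b1≉0)) public
      using (Q; vertex; base-hyperbolic)
    open Char2Solver R char2 using (solve; _:=_; con; _:+_; _:*_)
    open ListCount using (count; count-cong; count-∨; count-×; count-true)

    a : F2
    a = a0 , a1

    affine-correspondence : ∀ x1 x2 x3 x4 x5 x6 →
      InMaff q (a0 , a1) (b0 , b1) (x1 , x2) (x3 , x4) (x5 , x6) ⇔ (Q (1# ∷ x1 ∷ x2 ∷ x3 ∷ x4 ∷ x5 ∷ x6 ∷ []) ≈ 0#)
    affine-correspondence x1 x2 x3 x4 x5 x6 = mk⇔ (trans (sym equation)) (trans equation)
      where
      x = x1 , x2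
      y = x3 , x4
      z = x5 , x6
      b = b0 , b1
      equation : proj₂ ((z ⊕ (a ⊗ (pow₂ x 2 ⊕ pow₂ y 2))) ⊖ (b ⊗ (pow₂ x (suc q) ⊕ pow₂ y (suc q))))
                 ≈ Q (1# ∷ x1 ∷ x2 ∷ x3 ∷ x4 ∷ x5 ∷ x6 ∷ [])
      equation = trans (proj₂ (⊖-cong (≈₂-refl {z ⊕ (a ⊗ (pow₂ x 2 ⊕ pow₂ y 2))}) (⊗-cong (≈₂-refl {b}) (⊕-cong (pow₂-suc-q x) (pow₂-suc-q y)))))
        (solve 11 (λ x1 x2 x3 x4 x5 x6 a0 a1 b0 b1 d →
           let x = x1 , x2 ; y = x3 , x4 ; 1ₛ = con true , con false
           in proj₂ (Syn.sub (Syn.add (x5 , x6) (Syn.mul d (a0 , a1) (Syn.add (Syn.mul d x (Syn.mul d x 1ₛ)) (Syn.mul d y (Syn.mul d y 1ₛ)))))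
                             (Syn.mul d (b0 , b1) (Syn.add (Syn.norm d x , con false) (Syn.norm d y , con false))))
              := Syn.q7 a0 a1 b1 d (con true ∷ x1 ∷ x2 ∷ x3 ∷ x4 ∷ x5 ∷ x6 ∷ []))
           refl x1 x2 x3 x4 x5 x6 a0 a1 b0 b1 δ)

    Q-at-infinity : ∀ X Y w → Q (0# ∷ proj₁ X ∷ proj₂ X ∷ proj₁ Y ∷ proj₂ Y ∷ proj₁ w ∷ proj₂ w ∷ [])
                              ≈ proj₂ (a ⊗ ((X ⊕ Y) ⊗ (X ⊕ Y))) + b1 * (Nm X + Nm Y)
    Q-at-infinity (x0 , x1) (y0 , y1) (w0 , w1) =
      solve 10 (λ x0 x1 y0 y1 w0 w1 a0 a1 b1 d →
        let X+Y = Syn.add (x0 , x1) (y0 , y1)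
        in Syn.q7 a0 a1 b1 d (con false ∷ x0 ∷ x1 ∷ y0 ∷ y1 ∷ w0 ∷ w1 ∷ [])
           := proj₂ (Syn.mul d (a0 , a1) (Syn.mul d X+Y X+Y)) :+ b1 :* (Syn.norm d (x0 , x1) :+ Syn.norm d (y0 , y1)))
        refl x0 x1 y0 y1 w0 w1 a0 a1 b1 δ

    restriction : F2 → F2 → F
    restriction e l = proj₂ (a ⊗ ((l ⊗ e) ⊗ (l ⊗ e)))

    restriction-cong : ∀ {e e′ l l′} → e ≈₂ e′ → l ≈₂ l′ → restriction e l ≈ restriction e′ l′
    restriction-cong e≈e′ l≈l′ = proj₂ (⊗-cong (≈₂-refl {a}) (⊗-cong (⊗-cong l≈l′ e≈e′) (⊗-cong l≈l′ e≈e′)))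

    Q-on-spread-line : ∀ u v w l → Nm u ≈ Nm v → Q (rPoint (u , v , w) l) ≈ restriction (u ⊕ v) l
    Q-on-spread-line u v w l Nu≈Nv = begin
      Q (rPoint (u , v , w) l)                                                  ≈⟨ Q-at-infinity (l ⊗ u) (l ⊗ v) (l ⊗ w) ⟩
      proj₂ (a ⊗ (((l ⊗ u) ⊕ (l ⊗ v)) ⊗ ((l ⊗ u) ⊕ (l ⊗ v)))) + b1 * (Nm (l ⊗ u) + Nm (l ⊗ v))
                                     ≈⟨ +-cong (proj₂ (⊗-cong (≈₂-refl {a}) (⊗-cong factor-l factor-l))) (*-congˡ norms-cancel) ⟩
      restriction (u ⊕ v) l + b1 * 0#                                           ≈⟨ +-congˡ (zeroʳ b1) ⟩
      restriction (u ⊕ v) l + 0#                                                ≈⟨ +-identityʳ _ ⟩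
      restriction (u ⊕ v) l                                                     ∎
      where
      open Relation.Binary.Reasoning.Setoid setoid
      factor-l : ((l ⊗ u) ⊕ (l ⊗ v)) ≈₂ (l ⊗ (u ⊕ v))
      factor-l = ≈₂-sym (⊗-distribˡ-⊕ l u v)
      norms-cancel : Nm (l ⊗ u) + Nm (l ⊗ v) ≈ 0#
      norms-cancel = Equivalence.from +≈0⇔≈ (trans (Nm-⊗ l u) (trans (*-congˡ Nu≈Nv) (sym (Nm-⊗ l v))))

    restriction-zero : ∀ l → restriction 0₂ l ≈ 0#
    restriction-zero (l0 , l1) =
      solve 5 (λ a0 a1 l0 l1 d → let l·0 = Syn.mul d (l0 , l1) (con false , con false)
                                 in proj₂ (Syn.mul d (a0 , a1) (Syn.mul d l·0 l·0)) := con false)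
        refl a0 a1 l0 l1 δ

    -- With f = a e² ≠ 0, the values at 1 and ε are f₁ and f₀ + (δ + 1) f₁, which cannot both vanish.
    restriction-witness : ∀ {e} → ¬ (e ≈₂ 0₂) → ∃ λ l → restriction e l ≉ 0#
    restriction-witness {e@(e0 , e1)} e≉0 = witness (proj₂ f ≟ 0#)
      where
      open Relation.Binary.Reasoning.Setoid setoid
      f = a ⊗ (e ⊗ e)
      f≉0 : ¬ (f ≈₂ 0₂)
      f≉0 = ⊗-≉0 a≉0 (⊗-≉0 e≉0 e≉0)
      at-1 : restriction e 1₂ ≈ proj₂ f
      at-1 = solve 5 (λ a0 a1 e0 e1 d → let 1·e = Syn.mul d (con true , con false) (e0 , e1)
                                        in proj₂ (Syn.mul d (a0 , a1) (Syn.mul d 1·e 1·e))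
                                           := proj₂ (Syn.mul d (a0 , a1) (Syn.mul d (e0 , e1) (e0 , e1))))
               refl a0 a1 e0 e1 δ
      at-ε : restriction e (0# , 1#) ≈ proj₁ f + (δ + 1#) * proj₂ f
      at-ε = solve 5 (λ a0 a1 e0 e1 d → let ε·e = Syn.mul d (con false , con true) (e0 , e1)
                                            f = Syn.mul d (a0 , a1) (Syn.mul d (e0 , e1) (e0 , e1))
                                        in proj₂ (Syn.mul d (a0 , a1) (Syn.mul d ε·e ε·e)) := proj₁ f :+ (d :+ con true) :* proj₂ f)
               refl a0 a1 e0 e1 δ
      witness : Dec (proj₂ f ≈ 0#) → ∃ λ l → restriction e l ≉ 0#
      witness (no  f1≉0) = 1₂ , λ r≈0 → f1≉0 (trans (sym at-1) r≈0)
      witness (yes f1≈0) = (0# , 1#) , λ r≈0 → f≉0 (f0≈0 r≈0 , f1≈0)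
        where
        f0≈0 : restriction e (0# , 1#) ≈ 0# → proj₁ f ≈ 0#
        f0≈0 r≈0 = begin
          proj₁ f                              ≈⟨ +-identityʳ _ ⟨
          proj₁ f + 0#                         ≈⟨ +-congˡ (zeroʳ _) ⟨
          proj₁ f + (δ + 1#) * 0#              ≈⟨ +-congˡ (*-congˡ f1≈0) ⟨
          proj₁ f + (δ + 1#) * proj₂ f         ≈⟨ at-ε ⟨
          restriction e (0# , 1#)              ≈⟨ r≈0 ⟩
          0#                                   ∎

    lineInB′-≡ : ∀ u v w → Nm u ≈ Nm v → lineInB'ᵇ a0 a1 b1 (u , v , w) ≡ v ==₂ u
    lineInB′-≡ u v w Nu≈Nv with v ≟₂ u
    ... | yes v≈u = ≡.trans (allᵇ-true _ els₂ λ l → ==-true (begin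
      Q (rPoint (u , v , w) l)   ≈⟨ Q-on-spread-line u v w l Nu≈Nv ⟩
      restriction (u ⊕ v) l      ≈⟨ restriction-cong u+v≈0 (≈₂-refl {l}) ⟩
      restriction 0₂ l           ≈⟨ restriction-zero l ⟩
      0#                         ∎)) (≡.sym (==₂-true v≈u))
      where
      open Relation.Binary.Reasoning.Setoid setoid
      u+v≈0 : (u ⊕ v) ≈₂ 0₂
      u+v≈0 = Equivalence.from +≈0⇔≈ (sym (proj₁ v≈u)) , Equivalence.from +≈0⇔≈ (sym (proj₂ v≈u))
    ... | no  v≉u = ≡.trans (allᵇ-false _ els₂ (Any.map l₀-witnesses (complete₂ l₀))) (≡.sym (==₂-false v≉u))
      where
      open Relation.Binary.Reasoning.Setoid setoid
      u+v≉0 : ¬ ((u ⊕ v) ≈₂ 0₂)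
      u+v≉0 (p , r) = v≉u (sym (Equivalence.to +≈0⇔≈ p) , sym (Equivalence.to +≈0⇔≈ r))
      l₀ = proj₁ (restriction-witness u+v≉0)
      l₀-witnesses : ∀ {l} → l₀ ≈₂ l → Q (rPoint (u , v , w) l) == 0# ≡ false
      l₀-witnesses {l} l₀≈l = ==-false λ Q≈0 → proj₂ (restriction-witness u+v≉0) (begin
        restriction (u ⊕ v) l₀     ≈⟨ restriction-cong (≈₂-refl {u ⊕ v}) l₀≈l ⟩
        restriction (u ⊕ v) l      ≈⟨ Q-on-spread-line u v w l Nu≈Nv ⟨
        Q (rPoint (u , v , w) l)   ≈⟨ Q≈0 ⟩
        0#                         ∎)

    inMinf-≡ : ∀ X Y Z → inMinfᵇ q (X , Y , Z) ≡ Nm X == Nm Y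
    inMinf-≡ X Y Z = ≡.trans (==₂-respˡ 0₂ (⊕-cong (pow₂-suc-q X) (pow₂-suc-q Y)))
      (does-⇔ (mk⇔ (λ sum≈0 → Equivalence.to +≈0⇔≈ (proj₁ sum≈0)) (λ NX≈NY → Equivalence.from +≈0⇔≈ NX≈NY , +-identityˡ 0#))
              ((Nm X + Nm Y , 0# + 0#) ≟₂ 0₂) (Nm X ≟ Nm Y))

    inMinf∧lineInB′-≡ : ∀ X Y Z → inMinfᵇ q (X , Y , Z) ∧ lineInB'ᵇ a0 a1 b1 (X , Y , Z) ≡ Y ==₂ X
    inMinf∧lineInB′-≡ X Y Z rewrite inMinf-≡ X Y Z with Nm X ≟ Nm Y
    ... | yes NX≈NY = lineInB′-≡ X Y Z NX≈NY
    ... | no  NX≉NY = ≡.sym (==₂-false (λ Y≈X → NX≉NY (Nm-cong (≈₂-sym Y≈X))))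

    normalised-∧-skeleton : ∀ x0 x1 y0 y1 z1 s t → (x0 ≡ true → x1 ≡ false) → (x1 ≡ true → s ≡ t) → (x0 ≡ true → s ≡ y0) →
      (if not x0 then x1 else if not y0 then y1 else z1) ∧ s ≡ (x1 ∧ t) ∨ (x0 ∧ (y0 ∧ z1))
    normalised-∧-skeleton false false _  _  _  _ _ _ _   _ = ≡.refl
    normalised-∧-skeleton false true  _  _  _  s t _ s≡t _ = ≡.trans (s≡t ≡.refl) (≡.sym (∨-identityʳ t))
    normalised-∧-skeleton true  x1    y0 y1 z1 s t x1≡false _ s≡y0 rewrite x1≡false ≡.refl | s≡y0 ≡.refl with y0
    ... | true  = ∧-identityʳ z1
    ... | false = ∧-zeroʳ y1

    X==0⇒X==1≡false : ∀ X → X ==₂ 0₂ ≡ true → X ==₂ 1₂ ≡ false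
    X==0⇒X==1≡false X X==0 = ==₂-false (λ X≈1 → 0≉1 (trans (sym (proj₁ (==₂-sound X==0))) (proj₁ X≈1)))

    -- The normalised points at infinity are (1 , Y , Z), (0 , 1 , Z) and (0 , 0 , 1).
    count-normalised : ∀ (S : F2 × F2 × F2 → Bool) (T : F2 → Bool) →
      (∀ X Y Z → X ==₂ 1₂ ≡ true → S (X , Y , Z) ≡ T Y) →
      (∀ X Y Z → X ==₂ 0₂ ≡ true → S (X , Y , Z) ≡ Y ==₂ 0₂) →
      count (λ P → normalisedᵇ P ∧ S P) triples ≡ count T els₂ *ℕ (q *ℕ q) +ℕ 1
    count-normalised S T S-at-1 S-at-0 = begin
      count (λ P → normalisedᵇ P ∧ S P) triples   ≡⟨ count-cong pointwise triples ⟩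
      count (λ P → affine P ∨ last P) triples     ≡⟨ count-∨ affine last disjoint triples ⟩
      count affine triples +ℕ count last triples  ≡⟨ ≡.cong₂ _+ℕ_ count-affine count-last ⟩
      count T els₂ *ℕ (q *ℕ q) +ℕ 1               ∎
      where
      open ≡.≡-Reasoning
      pairs = cartesianProduct els₂ els₂
      affine last : F2 × F2 × F2 → Bool
      affine (X , Y , Z) = X ==₂ 1₂ ∧ T Y
      last   (X , Y , Z) = X ==₂ 0₂ ∧ (Y ==₂ 0₂ ∧ Z ==₂ 1₂)
      pointwise : ∀ P → normalisedᵇ P ∧ S P ≡ affine P ∨ last P
      pointwise (X , Y , Z) =
        normalised-∧-skeleton (X ==₂ 0₂) (X ==₂ 1₂) (Y ==₂ 0₂) (Y ==₂ 1₂) (Z ==₂ 1₂) (S (X , Y , Z)) (T Y)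
          (X==0⇒X==1≡false X) (S-at-1 X Y Z) (S-at-0 X Y Z)
      disjoint : ∀ P → affine P ∧ last P ≡ false
      disjoint (X , Y , Z) with X ==₂ 0₂ in X==0
      ... | false = ∧-zeroʳ (affine (X , Y , Z))
      ... | true  rewrite X==0⇒X==1≡false X X==0 = ≡.refl
      count-affine : count affine triples ≡ count T els₂ *ℕ (q *ℕ q)
      count-affine = begin
        count affine triples                                        ≡⟨ count-× (_==₂ 1₂) (λ YZ → T (proj₁ YZ)) els₂ pairs ⟩
        count (_==₂ 1₂) els₂ *ℕ count (λ YZ → T (proj₁ YZ)) pairs   ≡⟨ ≡.cong (_*ℕ count (λ YZ → T (proj₁ YZ)) pairs) (els₂-enumeratesOnce 1₂) ⟩
        1 *ℕ count (λ YZ → T (proj₁ YZ)) pairs                      ≡⟨ *ℕ-identityˡ _ ⟩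
        count (λ YZ → T (proj₁ YZ)) pairs                           ≡⟨ count-cong (λ YZ → ≡.sym (∧-identityʳ (T (proj₁ YZ)))) pairs ⟩
        count (λ YZ → T (proj₁ YZ) ∧ true) pairs                    ≡⟨ count-× T (λ _ → true) els₂ els₂ ⟩
        count T els₂ *ℕ count (λ _ → true) els₂                     ≡⟨ ≡.cong (count T els₂ *ℕ_) (≡.trans (count-true els₂) length-els₂) ⟩
        count T els₂ *ℕ (q *ℕ q)                                    ∎
      count-last : count last triples ≡ 1
      count-last = begin
        count last triples                                                              ≡⟨ count-× (_==₂ 0₂) _ els₂ pairs ⟩
        count (_==₂ 0₂) els₂ *ℕ count (λ YZ → proj₁ YZ ==₂ 0₂ ∧ proj₂ YZ ==₂ 1₂) pairs  ≡⟨ ≡.cong₂ _*ℕ_ (els₂-enumeratesOnce 0₂)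
                                                                                             (count-× (_==₂ 0₂) (_==₂ 1₂) els₂ els₂) ⟩
        1 *ℕ (count (_==₂ 0₂) els₂ *ℕ count (_==₂ 1₂) els₂)                              ≡⟨ ≡.cong₂ (λ m n → 1 *ℕ (m *ℕ n))
                                                                                             (els₂-enumeratesOnce 0₂) (els₂-enumeratesOnce 1₂) ⟩
        1                                                                               ∎

    module _ {h′ : ℕ} (h≡suc : h ≡ suc h′) where

      count-points-at-infinity : count (λ P → normalisedᵇ P ∧ inMinfᵇ q P) triples ≡ q ^ 3 +ℕ q ^ 2 +ℕ 1
      count-points-at-infinity = begin
        count (λ P → normalisedᵇ P ∧ inMinfᵇ q P) triples      ≡⟨ count-normalised (inMinfᵇ q) (λ Y → Nm Y == 1#) at-1 at-0 ⟩
        count (λ Y → Nm Y == 1#) els₂ *ℕ (q *ℕ q) +ℕ 1         ≡⟨ ≡.cong (λ k → k *ℕ (q *ℕ q) +ℕ 1) (Nm-fibre-1 h≡suc) ⟩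
        suc q *ℕ (q *ℕ q) +ℕ 1                                  ≡⟨ ≡.cong (_+ℕ 1) (expand q) ⟩
        q ^ 3 +ℕ q ^ 2 +ℕ 1                                     ∎
        where
        open ≡.≡-Reasoning
        at-1 : ∀ X Y Z → X ==₂ 1₂ ≡ true → inMinfᵇ q (X , Y , Z) ≡ Nm Y == 1#
        at-1 X Y Z X==1 = ≡.trans (inMinf-≡ X Y Z) (≡.trans (==-respˡ (Nm Y) (trans (Nm-cong (==₂-sound X==1)) Nm-1)) (==-sym 1# (Nm Y)))
        at-0 : ∀ X Y Z → X ==₂ 0₂ ≡ true → inMinfᵇ q (X , Y , Z) ≡ Y ==₂ 0₂
        at-0 X Y Z X==0 = ≡.trans (inMinf-≡ X Y Z)
          (≡.trans (==-respˡ (Nm Y) (trans (Nm-cong (==₂-sound X==0)) Nm-0)) (≡.trans (==-sym 0# (Nm Y)) (Nm==0≡==₂0 Y)))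
        expand : ∀ q → suc q *ℕ (q *ℕ q) ≡ q ^ 3 +ℕ q ^ 2
        expand q = ≡.trans (+ℕ-comm (q *ℕ q) (q *ℕ (q *ℕ q)))
          (≡.cong₂ _+ℕ_ (≡.cong (λ m → q *ℕ (q *ℕ m)) (≡.sym (*ℕ-identityʳ q))) (≡.cong (q *ℕ_) (≡.sym (*ℕ-identityʳ q))))

    count-lines-in-B′ : count (λ P → normalisedᵇ P ∧ inMinfᵇ q P ∧ lineInB'ᵇ a0 a1 b1 P) triples ≡ q ^ 2 +ℕ 1
    count-lines-in-B′ = begin
      count (λ P → normalisedᵇ P ∧ inMinfᵇ q P ∧ lineInB'ᵇ a0 a1 b1 P) triples
          ≡⟨ count-normalised (λ P → inMinfᵇ q P ∧ lineInB'ᵇ a0 a1 b1 P) (_==₂ 1₂)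
               (λ X Y Z X==1 → ≡.trans (inMinf∧lineInB′-≡ X Y Z) (==₂-respʳ Y (==₂-sound X==1)))
               (λ X Y Z X==0 → ≡.trans (inMinf∧lineInB′-≡ X Y Z) (==₂-respʳ Y (==₂-sound X==0))) ⟩
      count (_==₂ 1₂) els₂ *ℕ (q *ℕ q) +ℕ 1      ≡⟨ ≡.cong (λ k → k *ℕ (q *ℕ q) +ℕ 1) (els₂-enumeratesOnce 1₂) ⟩
      1 *ℕ (q *ℕ q) +ℕ 1                         ≡⟨ ≡.cong (_+ℕ 1) (≡.trans (*ℕ-identityˡ (q *ℕ q)) (≡.cong (q *ℕ_) (≡.sym (*ℕ-identityʳ q)))) ⟩
      q ^ 2 +ℕ 1                                 ∎
      where open ≡.≡-Reasoning

theorem6p3 : ∀ {c ℓ} (R : CommutativeRing c ℓ)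
    (_≟_ : Decidable (CommutativeRing._≈_ R))
    (els : List (CommutativeRing.Carrier R)) →
    let open CommutativeRing R
        open BM R _≟_ els
    in
    (h : ℕ) → 2 ≤ h → IsFiniteFieldOfOrder (2 ^ h) → 1# + 1# ≈ 0# →
    (δ : F) → absTrace h δ ≈ 1# →
    (a0 a1 b0 b1 : F) → ¬ (a0 ≈ 0# × a1 ≈ 0#) → ¬ (b1 ≈ 0#) →
    let q = 2 ^ h
        open Ext δ
        Q = Q7 a0 a1 b1
    in
      (∀ x1 x2 x3 x4 x5 x6 →
         InMaff q (a0 , a1) (b0 , b1) (x1 , x2) (x3 , x4) (x5 , x6)
           ⇔ (Q (1# ∷ x1 ∷ x2 ∷ x3 ∷ x4 ∷ x5 ∷ x6 ∷ []) ≈ 0#))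
    × HasVertex Q vertexV
    × IsHyperbolic (baseOf Q)
    × count (λ P → normalisedᵇ P ∧ inMinfᵇ q P) triples ≡ q ^ 3 +ℕ q ^ 2 +ℕ 1
    × count (λ P → normalisedᵇ P ∧ inMinfᵇ q P ∧ lineInB'ᵇ a0 a1 b1 P) triples ≡ q ^ 2 +ℕ 1
theorem6p3 R _≟_ els zero      ()
theorem6p3 R _≟_ els (suc h′) _ isFiniteField char2 δ trace≈1 a0 a1 b0 b1 a≉0 b1≉0 =
  affine-correspondence , vertex , base-hyperbolic b1≉0 , count-points-at-infinity ≡.refl , count-lines-in-B′
  where open Over.BMVariety R _≟_ els (suc h′) isFiniteField char2 δ trace≈1 a0 a1 b0 b1 a≉0 b1≉0
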